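{- For any $t\in\mathbb{N}$, the $t$-expansion of a gammoid is a gammoid.
   Context: A gammoid is a minor of a transversal matroid (a transversal matroid being a matroid union of rank-$1$ matroids). A cyclic flat of a matroid $M$ is a flat $F$ such that $M|F$ has no coloops; $\mathcal{Z}(M)$ denotes the set of cyclic flats, and a matroid is determined by its cyclic flats and their ranks. The $t$-expansion: for each $e\in E(M)$ let $S_e$ be a $t$-element set with $e\in S_e$, the sets $S_e$ pairwise disjoint; for $X\subseteq E(M)$ let $S_X=\bigcup_{e\in X}S_e$. The $t$-expansion $M^t$ is the matroid on $S_{E(M)}$ whose cyclic flats are exactly the sets $S_A$ with $A\in\mathcal{Z}(M)$, with $r_{M^t}(S_A)=t\cdot r_M(A)$. -}

module Defs where

open import Data.Nat using (ℕ; _+_; _*_; _≤_; _<_)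
open import Data.Fin using (Fin; zero; suc; quotient)
open import Data.Fin.Subset using (Subset; _∈_; _∉_; _⊆_; _∪_; _∩_; _-_; ∣_∣; ⊤; ⊥; ⁅_⁆; ∁)
open import Data.Vec using (tabulate; lookup)
open import Data.Product using (Σ; ∃; _×_; _,_)
open import Data.Sum using (_⊎_)
open import Relation.Binary.PropositionalEquality using (_≡_)
open import Function.Bundles using (_⇔_)
open import Function.Definitions using (Injective)

record Matroid (n : ℕ) : Set where
  field
    rank       : Subset n → ℕ
    rank-≤-card : ∀ X → rank X ≤ ∣ X ∣
    rank-mono  : ∀ {X Y} → X ⊆ Y → rank X ≤ rank Y
    rank-submod : ∀ X Y → rank (X ∪ Y) + rank (X ∩ Y) ≤ rank X + rank Y
open Matroid public

module _ {n : ℕ} (M : Matroid n) where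

  Indep : Subset n → Set
  Indep X = rank M X ≡ ∣ X ∣

  IsFlat : Subset n → Set
  IsFlat F = ∀ e → e ∉ F → rank M F < rank M (F ∪ ⁅ e ⁆)

  IsCyclic : Subset n → Set
  IsCyclic F = ∀ e → e ∈ F → rank M (F - e) ≡ rank M F

  IsCyclicFlat : Subset n → Set
  IsCyclicFlat F = IsFlat F × IsCyclic F

⋃ : ∀ {m k} → (Fin k → Subset m) → Subset m
⋃ {k = ℕ.zero}  I = ⊥
⋃ {k = ℕ.suc k} I = I zero ∪ ⋃ (λ i → I (suc i))

IsMatroidUnion : ∀ {m k} → Matroid m → (Fin k → Matroid m) → Set
IsMatroidUnion {m} {k} N Ms =
  ∀ X → Indep N X ⇔ (Σ (Fin k → Subset m) λ I → (∀ i → Indep (Ms i) (I i)) × X ≡ ⋃ I)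

IsTransversal : ∀ {m} → Matroid m → Set
IsTransversal {m} N =
  Σ ℕ λ k → Σ (Fin k → Matroid m) λ Ms →
    (∀ i → rank (Ms i) ⊤ ≡ 1) × IsMatroidUnion N Ms

preimage : ∀ {n m} → (Fin n → Fin m) → Subset m → Subset n
preimage φ X = tabulate (λ i → lookup X (φ i))

-- M is (isomorphic to) a minor N / C \ D of N: C, D disjoint, and φ is a
-- bijection from E(M) onto E(N) − (C ∪ D) with
-- r_M(φ⁻¹ X) = r_N(X ∪ C) − r_N(C) for every X ⊆ E(N) − (C ∪ D).
IsMinor : ∀ {n m} → Matroid n → Matroid m → Set
IsMinor {n} {m} M N =
  Σ (Subset m) λ C → Σ (Subset m) λ D → Σ (Fin n → Fin m) λ φ →
    (∀ j → j ∈ C → j ∉ D)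
    × Injective _≡_ _≡_ φ
    × (∀ i → φ i ∉ C × φ i ∉ D)
    × (∀ j → j ∈ C ⊎ j ∈ D ⊎ ∃ λ i → φ i ≡ j)
    × (∀ X → X ⊆ ∁ (C ∪ D) → rank M (preimage φ X) + rank N C ≡ rank N (X ∪ C))

IsGammoid : ∀ {n} → Matroid n → Set
IsGammoid {n} M = Σ ℕ λ m → Σ (Matroid m) λ N → IsTransversal N × IsMinor M N

-- t-expansion.  The ground set S_{E(M)} is modelled as Fin (n * t), with
-- S_e = { combine e j | j : Fin t } (the elements x with quotient t x ≡ e).
S[_] : ∀ {n} t → Subset n → Subset (n * t)
S[_] {n} t X = tabulate (λ x → lookup X (quotient {n} t x))

IsExpansion : ∀ {n} t → Matroid n → Matroid (n * t) → Set
IsExpansion {n} t M N =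
  (∀ Z → IsCyclicFlat N Z ⇔ (∃ λ A → IsCyclicFlat M A × Z ≡ S[ t ] A))
  × (∀ A → IsCyclicFlat M A → rank N (S[ t ] A) ≡ t * rank M A)

-- Let M = T / C \ D, where T is the transversal matroid presented by sets A₁, …, A_k.
-- By Hall's theorem T has Ore's rank function r_T(W) = min_Y (|W − Y| + #{i | Aᵢ meets W ∩ Y}),
-- so presenting each S_{Aᵢ} t times yields a transversal matroid T′ with
-- r_T′(W) = min_B (t·r_T(B) + |W − S_B|). Since a matroid is determined by its cyclic flats
-- through r(X) = min_F (r(F) + |X − F|), the t-expansion N of M has the rank function of the
-- same shape, r_N(X) = min_B (t·r_M(B) + |X − S_B|). This formula commutes with contraction
-- and deletion, so N = T′ / S_C \ S_D.

module Submission where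

open import Defs
open import Data.Bool using (Bool; true; false)
open import Data.Empty using (⊥-elim)
open import Data.Fin using (Fin; zero; suc; _↑ˡ_; _↑ʳ_; quotient; remainder; combine; remQuot)
open import Data.Fin.Properties using (any?; suc-injective; remQuot-combine; combine-remQuot) renaming (_≟_ to _≟ᶠ_)
open import Data.Fin.Subset using (Subset; _∈_; _∉_; _⊆_; _∪_; _∩_; _─_; _-_; ∣_∣; ⊤; ⊥; ⁅_⁆; ∁; Nonempty; Empty)
open import Data.Fin.Subset.Properties
  using ( _∈?_; _⊆?_; nonempty?; anySubset?; ⊆-refl; ⊆-antisym; ∈⊤; ∉⊥; x∈⁅x⁆; x∈⁅y⁆⇒x≡y
        ; x∈p∪q⁺; x∈p∪q⁻; x∈p∩q⁺; x∈p∩q⁻; p∩q⊆p; p∩q⊆q; p⊆p∪q; p─q⊆p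
        ; x∈p∧x∉q⇒x∈p─q; x∈p∧x≢y⇒x∈p-y; x∈∁p⇒x∉p; x∉p⇒x∈∁p; Empty-unique
        ; p⊆q⇒∣p∣≤∣q∣; ∣p∩q∣≤∣p∣; p─⊥≡p; ∣⊥∣≡0; ∣⁅x⁆∣≡1; ∣p∣≤n; x∈p⇒∣p-x∣<∣p∣ )
open import Data.Nat using (ℕ; zero; suc; _+_; _*_; _∸_; _≤_; _<_; z≤n; s≤s; _≟_; _⊓_)
open import Data.Nat.Induction using (<-wellFounded)
open import Data.Nat.Properties hiding (suc-injective; _≟_)
open import Data.Nat.Solver using (module +-*-Solver)
open import Data.Product using (Σ; ∃; _×_; _,_; proj₁; proj₂)
open import Data.Sum using (_⊎_; inj₁; inj₂; [_,_]′)
open import Data.Vec using ([]; _∷_; lookup; tabulate; here; there)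
open import Data.Vec.Functional using (updateAt)
open import Data.Vec.Functional.Properties using (updateAt-updates; updateAt-minimal)
open import Data.Vec.Properties using ([]=⇒lookup; lookup⇒[]=; lookup∘tabulate)
open import Function using (id; _∘_; _⇔_; mk⇔; Equivalence; case_of_)
open import Function.Definitions using (Injective)
open import Induction.WellFounded using (Acc; acc)
open import Relation.Binary.PropositionalEquality
open import Relation.Nullary using (¬_; Dec; yes; no; does; contradiction)
open import Relation.Nullary.Decidable using (_×-dec_; ¬?; dec-true; dec-false)

open import Algebra.Properties.CommutativeSemigroup +-commutativeSemigroup using (interchange)
open import Algebra.Properties.Semiring.Sum +-*-semiring using (sum-syntax; sum-cong-≗; ∑-distrib-+; *-distribˡ-sum)
open +-*-Solver using (solve; _:+_; _:*_; _:=_)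

variable
  n m k t : ℕ

-- Finite sums

⟦_⟧ : Bool → ℕ
⟦ true ⟧  = 1
⟦ false ⟧ = 0

𝟙 : ∀ {P : Set} → Dec P → ℕ
𝟙 P? = ⟦ does P? ⟧

𝟙≤1 : ∀ {P : Set} (P? : Dec P) → 𝟙 P? ≤ 1
𝟙≤1 (yes _) = s≤s z≤n
𝟙≤1 (no _)  = z≤n

𝟙-yes : ∀ {P : Set} (P? : Dec P) → P → 𝟙 P? ≡ 1
𝟙-yes P? p = cong ⟦_⟧ (dec-true P? p)

𝟙-no : ∀ {P : Set} (P? : Dec P) → ¬ P → 𝟙 P? ≡ 0
𝟙-no P? ¬p = cong ⟦_⟧ (dec-false P? ¬p)

does⇒ : ∀ {P : Set} (P? : Dec P) → does P? ≡ true → P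
does⇒ (yes p) _ = p
does⇒ (no _) ()

0<𝟙⇒ : ∀ {P : Set} (P? : Dec P) → 0 < 𝟙 P? → P
0<𝟙⇒ (yes p) _ = p

𝟙-mono : ∀ {P Q : Set} (P? : Dec P) (Q? : Dec Q) → (P → Q) → 𝟙 P? ≤ 𝟙 Q?
𝟙-mono (no _)  _       _   = z≤n
𝟙-mono (yes p) Q? p⇒q = ≤-reflexive (sym (𝟙-yes Q? (p⇒q p)))

𝟙-cong : ∀ {P Q : Set} (P? : Dec P) (Q? : Dec Q) → (P → Q) → (Q → P) → 𝟙 P? ≡ 𝟙 Q?
𝟙-cong P? Q? p⇒q q⇒p = ≤-antisym (𝟙-mono P? Q? p⇒q) (𝟙-mono Q? P? q⇒p)

𝟙-submodular : ∀ {P Q R S : Set} (P? : Dec P) (Q? : Dec Q) (R? : Dec R) (S? : Dec S) →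
               (R → P ⊎ Q) → (S → P × Q) → 𝟙 R? + 𝟙 S? ≤ 𝟙 P? + 𝟙 Q?
𝟙-submodular P? Q? R? (yes s) _ s⇒pq
  rewrite 𝟙-yes P? (proj₁ (s⇒pq s)) | 𝟙-yes Q? (proj₂ (s⇒pq s)) = +-monoˡ-≤ 1 (𝟙≤1 R?)
𝟙-submodular P? Q? (no _) (no _) _ _ = z≤n
𝟙-submodular P? Q? (yes r) (no _) r⇒pq _ with r⇒pq r
... | inj₁ p rewrite 𝟙-yes P? p = s≤s z≤n
... | inj₂ q rewrite 𝟙-yes Q? q = m≤n+m 1 (𝟙 P?)

∑-mono-≤ : ∀ {f g : Fin n → ℕ} → (∀ i → f i ≤ g i) → ∑[ i < n ] f i ≤ ∑[ i < n ] g i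
∑-mono-≤ {zero}  _   = z≤n
∑-mono-≤ {suc n} f≤g = +-mono-≤ (f≤g zero) (∑-mono-≤ (f≤g ∘ suc))

∑-mono-< : ∀ {f g : Fin n → ℕ} i → (∀ j → f j ≤ g j) → f i < g i → ∑[ j < n ] f j < ∑[ j < n ] g j
∑-mono-< zero    f≤g fi<gi = +-mono-<-≤ fi<gi (∑-mono-≤ (f≤g ∘ suc))
∑-mono-< (suc i) f≤g fi<gi = +-mono-≤-< (f≤g zero) (∑-mono-< i (f≤g ∘ suc) fi<gi)

∑-mono-≤₂ : ∀ {f g f′ g′ : Fin n → ℕ} → (∀ i → f i + g i ≤ f′ i + g′ i) →
            ∑[ i < n ] f i + ∑[ i < n ] g i ≤ ∑[ i < n ] f′ i + ∑[ i < n ] g′ i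
∑-mono-≤₂ {f = f} {g} {f′} {g′} pointwise = subst₂ _≤_ (∑-distrib-+ f g) (∑-distrib-+ f′ g′) (∑-mono-≤ pointwise)

∑-const : ∀ n c → ∑[ i < n ] c ≡ n * c
∑-const zero    c = refl
∑-const (suc n) c = cong (c +_) (∑-const n c)

∑-zero : ∀ {f : Fin n → ℕ} → (∀ i → f i ≡ 0) → ∑[ i < n ] f i ≡ 0
∑-zero {zero}  _     = refl
∑-zero {suc n} f≡0 = cong₂ _+_ (f≡0 zero) (∑-zero (f≡0 ∘ suc))

∑-≤-single : ∀ {f : Fin n → ℕ} i → (∀ j → j ≢ i → f j ≡ 0) → ∑[ j < n ] f j ≤ f i
∑-≤-single {suc n} {f} zero others =
  ≤-reflexive (trans (cong (f zero +_) (∑-zero (λ j → others (suc j) λ ()))) (+-identityʳ (f zero)))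
∑-≤-single {suc n} {f} (suc i) others
  rewrite others zero (λ ()) = ∑-≤-single i (λ j j≢i → others (suc j) (j≢i ∘ suc-injective))

∑-pos : ∀ {f : Fin n → ℕ} → 0 < ∑[ i < n ] f i → ∃ λ i → 0 < f i
∑-pos {suc n} {f} pos with 0 <? f zero
... | yes f₀>0 = zero , f₀>0
... | no f₀≯0 with ∑-pos {f = f ∘ suc} (subst (λ a → 0 < a + ∑[ i < n ] f (suc i)) (n≤0⇒n≡0 (≮⇒≥ f₀≯0)) pos)
...   | i , fᵢ>0 = suc i , fᵢ>0

∑-++ : ∀ a b (f : Fin (a + b) → ℕ) →
       ∑[ i < a + b ] f i ≡ ∑[ i < a ] f (i ↑ˡ b) + ∑[ j < b ] f (a ↑ʳ j)
∑-++ zero    b f = refl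
∑-++ (suc a) b f = trans (cong (f zero +_) (∑-++ a b (f ∘ suc))) (sym (+-assoc (f zero) _ _))

∑-combine : ∀ n t (f : Fin (n * t) → ℕ) → ∑[ x < n * t ] f x ≡ ∑[ e < n ] ∑[ j < t ] f (combine e j)
∑-combine zero    t f = refl
∑-combine (suc n) t f = trans (∑-++ t (n * t) f) (cong (∑[ j < t ] f (j ↑ˡ (n * t)) +_) (∑-combine n t (f ∘ (t ↑ʳ_))))

-- Subsets

x∈p─q⇒x∉q : ∀ {p q : Subset n} {x} → x ∈ p ─ q → x ∉ q
x∈p─q⇒x∉q {p = true  ∷ p} {false ∷ q} here        ()
x∈p─q⇒x∉q {p = _     ∷ p} {_     ∷ q} (there x∈) (there x∈q) = x∈p─q⇒x∉q x∈ x∈q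

x∈p-y⇒x≢y : ∀ {p : Subset n} {x y} → x ∈ p - y → x ≢ y
x∈p-y⇒x≢y {y = y} x∈p-y refl = x∈p─q⇒x∉q x∈p-y (x∈⁅x⁆ y)

x∈p⇒⁅x⁆⊆p : ∀ {p : Subset n} {x} → x ∈ p → ⁅ x ⁆ ⊆ p
x∈p⇒⁅x⁆⊆p {p = p} {x} x∈p y∈⁅x⁆ = subst (_∈ p) (sym (x∈⁅y⁆⇒x≡y x y∈⁅x⁆)) x∈p

p∩r⊆q⇒p─q⊆p─r : ∀ {p q r : Subset n} → p ∩ r ⊆ q → p ─ q ⊆ p ─ r
p∩r⊆q⇒p─q⊆p─r {p = p} {q} p∩r⊆q x∈ =
  x∈p∧x∉q⇒x∈p─q x∈p (λ x∈r → x∈p─q⇒x∉q x∈ (p∩r⊆q (x∈p∩q⁺ (x∈p , x∈r))))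
  where x∈p = p─q⊆p p q x∈

∣∣≡∑ : ∀ (p : Subset n) → ∣ p ∣ ≡ ∑[ x < n ] ⟦ lookup p x ⟧
∣∣≡∑ []          = refl
∣∣≡∑ (true  ∷ p) = cong suc (∣∣≡∑ p)
∣∣≡∑ (false ∷ p) = ∣∣≡∑ p

∣p∪q∣+∣p∩q∣≡∣p∣+∣q∣ : ∀ (p q : Subset n) → ∣ p ∪ q ∣ + ∣ p ∩ q ∣ ≡ ∣ p ∣ + ∣ q ∣
∣p∪q∣+∣p∩q∣≡∣p∣+∣q∣ []          []          = refl
∣p∪q∣+∣p∩q∣≡∣p∣+∣q∣ (true  ∷ p) (true  ∷ q) =
  cong suc (trans (+-suc _ _) (trans (cong suc (∣p∪q∣+∣p∩q∣≡∣p∣+∣q∣ p q)) (sym (+-suc _ _))))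
∣p∪q∣+∣p∩q∣≡∣p∣+∣q∣ (true  ∷ p) (false ∷ q) = cong suc (∣p∪q∣+∣p∩q∣≡∣p∣+∣q∣ p q)
∣p∪q∣+∣p∩q∣≡∣p∣+∣q∣ (false ∷ p) (true  ∷ q) = trans (cong suc (∣p∪q∣+∣p∩q∣≡∣p∣+∣q∣ p q)) (sym (+-suc _ _))
∣p∪q∣+∣p∩q∣≡∣p∣+∣q∣ (false ∷ p) (false ∷ q) = ∣p∪q∣+∣p∩q∣≡∣p∣+∣q∣ p q

∣p∣+∣q∣≤∣r∣+∣s∣ : ∀ (p q r s : Subset n) → p ∪ q ⊆ r ∪ s → p ∩ q ⊆ r ∩ s →
                  ∣ p ∣ + ∣ q ∣ ≤ ∣ r ∣ + ∣ s ∣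
∣p∣+∣q∣≤∣r∣+∣s∣ p q r s ∪⊆∪ ∩⊆∩ = begin
  ∣ p ∣ + ∣ q ∣              ≡⟨ ∣p∪q∣+∣p∩q∣≡∣p∣+∣q∣ p q ⟨
  ∣ p ∪ q ∣ + ∣ p ∩ q ∣      ≤⟨ +-mono-≤ (p⊆q⇒∣p∣≤∣q∣ ∪⊆∪) (p⊆q⇒∣p∣≤∣q∣ ∩⊆∩) ⟩
  ∣ r ∪ s ∣ + ∣ r ∩ s ∣      ≡⟨ ∣p∪q∣+∣p∩q∣≡∣p∣+∣q∣ r s ⟩
  ∣ r ∣ + ∣ s ∣              ∎
  where open ≤-Reasoning

∣p∣≡∣p∩q∣+∣p─q∣ : ∀ (p q : Subset n) → ∣ p ∣ ≡ ∣ p ∩ q ∣ + ∣ p ─ q ∣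
∣p∣≡∣p∩q∣+∣p─q∣ []          []          = refl
∣p∣≡∣p∩q∣+∣p─q∣ (true  ∷ p) (true  ∷ q) = cong suc (∣p∣≡∣p∩q∣+∣p─q∣ p q)
∣p∣≡∣p∩q∣+∣p─q∣ (true  ∷ p) (false ∷ q) = trans (cong suc (∣p∣≡∣p∩q∣+∣p─q∣ p q)) (sym (+-suc _ _))
∣p∣≡∣p∩q∣+∣p─q∣ (false ∷ p) (true  ∷ q) = ∣p∣≡∣p∩q∣+∣p─q∣ p q
∣p∣≡∣p∩q∣+∣p─q∣ (false ∷ p) (false ∷ q) = ∣p∣≡∣p∩q∣+∣p─q∣ p q

∣p∪q∣≤∣p∣+∣q∣ : ∀ (p q : Subset n) → ∣ p ∪ q ∣ ≤ ∣ p ∣ + ∣ q ∣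
∣p∪q∣≤∣p∣+∣q∣ p q = ≤-trans (m≤m+n _ _) (≤-reflexive (∣p∪q∣+∣p∩q∣≡∣p∣+∣q∣ p q))

Empty⇒∣∣≡0 : ∀ {p : Subset n} → Empty p → ∣ p ∣ ≡ 0
Empty⇒∣∣≡0 {n} empty = trans (cong ∣_∣ (Empty-unique empty)) (∣⊥∣≡0 n)

∣p∣+∣q∣≤∣p∪q∣ : ∀ (p q : Subset n) → Empty (p ∩ q) → ∣ p ∣ + ∣ q ∣ ≤ ∣ p ∪ q ∣
∣p∣+∣q∣≤∣p∪q∣ p q disjoint = begin
  ∣ p ∣ + ∣ q ∣              ≡⟨ ∣p∪q∣+∣p∩q∣≡∣p∣+∣q∣ p q ⟨
  ∣ p ∪ q ∣ + ∣ p ∩ q ∣      ≡⟨ cong (∣ p ∪ q ∣ +_) (Empty⇒∣∣≡0 disjoint) ⟩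
  ∣ p ∪ q ∣ + 0              ≡⟨ +-identityʳ _ ⟩
  ∣ p ∪ q ∣                  ∎
  where open ≤-Reasoning

∣p─p∣≡0 : ∀ (p : Subset n) → ∣ p ─ p ∣ ≡ 0
∣p─p∣≡0 p = Empty⇒∣∣≡0 (λ (x , x∈) → x∈p─q⇒x∉q x∈ (p─q⊆p p p x∈))

∣p─r∣≤∣p─q∣+∣q─r∣ : ∀ (p q r : Subset n) → ∣ p ─ r ∣ ≤ ∣ p ─ q ∣ + ∣ q ─ r ∣
∣p─r∣≤∣p─q∣+∣q─r∣ p q r = ≤-trans (p⊆q⇒∣p∣≤∣q∣ split) (∣p∪q∣≤∣p∣+∣q∣ (p ─ q) (q ─ r))
  where
  split : p ─ r ⊆ (p ─ q) ∪ (q ─ r)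
  split {x} x∈p─r with x ∈? q
  ... | yes x∈q = x∈p∪q⁺ (inj₂ (x∈p∧x∉q⇒x∈p─q x∈q (x∈p─q⇒x∉q x∈p─r)))
  ... | no  x∉q = x∈p∪q⁺ (inj₁ (x∈p∧x∉q⇒x∈p─q (p─q⊆p p r x∈p─r) x∉q))

∣p─r∣+∣q─r∣≤∣p∪q─r∣ : ∀ (p q r : Subset n) → Empty (p ∩ q) →
                      ∣ p ─ r ∣ + ∣ q ─ r ∣ ≤ ∣ (p ∪ q) ─ r ∣
∣p─r∣+∣q─r∣≤∣p∪q─r∣ p q r disjoint =
  ≤-trans (∣p∣+∣q∣≤∣p∪q∣ (p ─ r) (q ─ r) disjoint′) (p⊆q⇒∣p∣≤∣q∣ ⊆p∪q─r)
  where
  disjoint′ : Empty ((p ─ r) ∩ (q ─ r))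
  disjoint′ (x , x∈) = let (x∈p─r , x∈q─r) = x∈p∩q⁻ (p ─ r) (q ─ r) x∈ in
    disjoint (x , x∈p∩q⁺ (p─q⊆p p r x∈p─r , p─q⊆p q r x∈q─r))
  ⊆p∪q─r : (p ─ r) ∪ (q ─ r) ⊆ (p ∪ q) ─ r
  ⊆p∪q─r x∈ with x∈p∪q⁻ (p ─ r) (q ─ r) x∈
  ... | inj₁ x∈p─r = x∈p∧x∉q⇒x∈p─q (x∈p∪q⁺ (inj₁ (p─q⊆p p r x∈p─r))) (x∈p─q⇒x∉q x∈p─r)
  ... | inj₂ x∈q─r = x∈p∧x∉q⇒x∈p─q (x∈p∪q⁺ (inj₂ (p─q⊆p q r x∈q─r))) (x∈p─q⇒x∉q x∈q─r)

suc∣p-x∣≡∣p∣ : ∀ {p : Subset n} {x} → x ∈ p → suc ∣ p - x ∣ ≡ ∣ p ∣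
suc∣p-x∣≡∣p∣ {p = p} {x} x∈p = begin
  suc ∣ p - x ∣             ≡⟨ cong (_+ ∣ p - x ∣) (∣⁅x⁆∣≡1 x) ⟨
  ∣ ⁅ x ⁆ ∣ + ∣ p - x ∣     ≡⟨ cong (λ s → ∣ s ∣ + ∣ p - x ∣) p∩⁅x⁆≡⁅x⁆ ⟨
  ∣ p ∩ ⁅ x ⁆ ∣ + ∣ p - x ∣ ≡⟨ ∣p∣≡∣p∩q∣+∣p─q∣ p ⁅ x ⁆ ⟨
  ∣ p ∣                     ∎
  where
  open ≡-Reasoning
  p∩⁅x⁆≡⁅x⁆ : p ∩ ⁅ x ⁆ ≡ ⁅ x ⁆
  p∩⁅x⁆≡⁅x⁆ = ⊆-antisym (p∩q⊆q p ⁅ x ⁆) (λ y∈⁅x⁆ → x∈p∩q⁺ (x∈p⇒⁅x⁆⊆p x∈p y∈⁅x⁆ , y∈⁅x⁆))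

∣p∪⁅x⁆∣≡suc∣p∣ : ∀ {p : Subset n} {x} → x ∉ p → ∣ p ∪ ⁅ x ⁆ ∣ ≡ suc ∣ p ∣
∣p∪⁅x⁆∣≡suc∣p∣ {p = p} {x} x∉p = begin
  ∣ p ∪ ⁅ x ⁆ ∣                    ≡⟨ +-identityʳ _ ⟨
  ∣ p ∪ ⁅ x ⁆ ∣ + 0                ≡⟨ cong (∣ p ∪ ⁅ x ⁆ ∣ +_) (Empty⇒∣∣≡0 disjoint) ⟨
  ∣ p ∪ ⁅ x ⁆ ∣ + ∣ p ∩ ⁅ x ⁆ ∣    ≡⟨ ∣p∪q∣+∣p∩q∣≡∣p∣+∣q∣ p ⁅ x ⁆ ⟩
  ∣ p ∣ + ∣ ⁅ x ⁆ ∣                ≡⟨ cong (∣ p ∣ +_) (∣⁅x⁆∣≡1 x) ⟩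
  ∣ p ∣ + 1                        ≡⟨ +-comm _ 1 ⟩
  suc ∣ p ∣                        ∎
  where
  open ≡-Reasoning
  disjoint : Empty (p ∩ ⁅ x ⁆)
  disjoint (y , y∈p∩⁅x⁆) with x∈p∩q⁻ p ⁅ x ⁆ y∈p∩⁅x⁆
  ... | y∈p , y∈⁅x⁆ = x∉p (subst (_∈ p) (x∈⁅y⁆⇒x≡y x y∈⁅x⁆) y∈p)

∈⇒0<∣∣ : ∀ {p : Subset n} {x} → x ∈ p → 0 < ∣ p ∣
∈⇒0<∣∣ x∈p = subst (0 <_) (suc∣p-x∣≡∣p∣ x∈p) (s≤s z≤n)

∈-preimage⁺ : ∀ (φ : Fin n → Fin m) {P x} → φ x ∈ P → x ∈ preimage φ P
∈-preimage⁺ φ {P} {x} φx∈P = lookup⇒[]= x (preimage φ P) (trans (lookup∘tabulate (lookup P ∘ φ) x) ([]=⇒lookup φx∈P))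

∈-preimage⁻ : ∀ (φ : Fin n → Fin m) {P x} → x ∈ preimage φ P → φ x ∈ P
∈-preimage⁻ φ {P} {x} x∈φ⁻P = lookup⇒[]= (φ x) P (trans (sym (lookup∘tabulate (lookup P ∘ φ) x)) ([]=⇒lookup x∈φ⁻P))

image : (Fin n → Fin m) → Subset n → Subset m
image φ []          = ⊥
image φ (true  ∷ P) = image (φ ∘ suc) P ∪ ⁅ φ zero ⁆
image φ (false ∷ P) = image (φ ∘ suc) P

∈-image⁺ : ∀ (φ : Fin n → Fin m) {P x} → x ∈ P → φ x ∈ image φ P
∈-image⁺ φ {true  ∷ P} here        = x∈p∪q⁺ (inj₂ (x∈⁅x⁆ (φ zero)))
∈-image⁺ φ {true  ∷ P} (there x∈P) = x∈p∪q⁺ (inj₁ (∈-image⁺ (φ ∘ suc) x∈P))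
∈-image⁺ φ {false ∷ P} (there x∈P) = ∈-image⁺ (φ ∘ suc) x∈P

∈-image⁻ : ∀ (φ : Fin n → Fin m) P {y} → y ∈ image φ P → ∃ λ x → x ∈ P × φ x ≡ y
∈-image⁻ φ []          y∈ = contradiction y∈ ∉⊥
∈-image⁻ φ (true  ∷ P) y∈ with x∈p∪q⁻ (image (φ ∘ suc) P) ⁅ φ zero ⁆ y∈
... | inj₂ y∈⁅φ₀⁆ = zero , here , sym (x∈⁅y⁆⇒x≡y _ y∈⁅φ₀⁆)
... | inj₁ y∈rest with ∈-image⁻ (φ ∘ suc) P y∈rest
...   | x , x∈P , φx≡y = suc x , there x∈P , φx≡y
∈-image⁻ φ (false ∷ P) y∈ with ∈-image⁻ (φ ∘ suc) P y∈
... | x , x∈P , φx≡y = suc x , there x∈P , φx≡y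

∣image∣≡∣∣ : ∀ {φ : Fin n → Fin m} → Injective _≡_ _≡_ φ → ∀ P → ∣ image φ P ∣ ≡ ∣ P ∣
∣image∣≡∣∣ {m = m} φ-inj []          = ∣⊥∣≡0 m
∣image∣≡∣∣ φ-inj (false ∷ P) = ∣image∣≡∣∣ (suc-injective ∘ φ-inj) P
∣image∣≡∣∣ {φ = φ} φ-inj (true  ∷ P) =
  trans (∣p∪⁅x⁆∣≡suc∣p∣ φ₀∉rest) (cong suc (∣image∣≡∣∣ (suc-injective ∘ φ-inj) P))
  where
  φ₀∉rest : φ zero ∉ image (φ ∘ suc) P
  φ₀∉rest φ₀∈ with ∈-image⁻ (φ ∘ suc) P φ₀∈
  ... | x , _ , φsx≡φ₀ = case φ-inj φsx≡φ₀ of λ ()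

preimage-image : ∀ {φ : Fin n → Fin m} → Injective _≡_ _≡_ φ → ∀ P → preimage φ (image φ P) ≡ P
preimage-image {φ = φ} φ-inj P = ⊆-antisym from (∈-preimage⁺ φ ∘ ∈-image⁺ φ)
  where
  from : preimage φ (image φ P) ⊆ P
  from x∈ with ∈-image⁻ φ P (∈-preimage⁻ φ x∈)
  ... | x′ , x′∈P , φx′≡φx = subst (_∈ P) (φ-inj φx′≡φx) x′∈P

image-preimage⊆ : ∀ (φ : Fin n → Fin m) P → image φ (preimage φ P) ⊆ P
image-preimage⊆ φ P y∈ with ∈-image⁻ φ (preimage φ P) y∈
... | x , x∈φ⁻P , refl = ∈-preimage⁻ φ x∈φ⁻P

∣preimage∣≡∣∣ : ∀ {φ : Fin n → Fin m} → Injective _≡_ _≡_ φ → ∀ {P} →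
                (∀ {y} → y ∈ P → ∃ λ x → φ x ≡ y) → ∣ preimage φ P ∣ ≡ ∣ P ∣
∣preimage∣≡∣∣ {φ = φ} φ-inj {P} P⊆range =
  trans (sym (∣image∣≡∣∣ φ-inj (preimage φ P))) (cong ∣_∣ (⊆-antisym (image-preimage⊆ φ P) P⊆image))
  where
  P⊆image : P ⊆ image φ (preimage φ P)
  P⊆image y∈P with P⊆range y∈P
  ... | x , refl = ∈-image⁺ φ (∈-preimage⁺ φ y∈P)

∈-⋃⁺ : ∀ (I : Fin k → Subset m) i {x} → x ∈ I i → x ∈ ⋃ I
∈-⋃⁺ I zero    x∈ = x∈p∪q⁺ (inj₁ x∈)
∈-⋃⁺ I (suc i) x∈ = x∈p∪q⁺ (inj₂ (∈-⋃⁺ (I ∘ suc) i x∈))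

∈-⋃⁻ : ∀ (I : Fin k → Subset m) {x} → x ∈ ⋃ I → ∃ λ i → x ∈ I i
∈-⋃⁻ {zero}  I x∈ = contradiction x∈ ∉⊥
∈-⋃⁻ {suc k} I x∈ with x∈p∪q⁻ (I zero) (⋃ (I ∘ suc)) x∈
... | inj₁ x∈I₀ = zero , x∈I₀
... | inj₂ x∈⋃ with ∈-⋃⁻ (I ∘ suc) x∈⋃
...   | i , x∈Iᵢ = suc i , x∈Iᵢ

∣⋃∣≤∑ : ∀ (I : Fin k → Subset m) → ∣ ⋃ I ∣ ≤ ∑[ i < k ] ∣ I i ∣
∣⋃∣≤∑ {zero} {m} I = ≤-reflexive (∣⊥∣≡0 m)
∣⋃∣≤∑ {suc k} I = ≤-trans (∣p∪q∣≤∣p∣+∣q∣ (I zero) (⋃ (I ∘ suc))) (+-monoʳ-≤ ∣ I zero ∣ (∣⋃∣≤∑ (I ∘ suc)))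

minSubset : (Subset n → ℕ) → ℕ
minSubset {zero}  f = f []
minSubset {suc n} f = minSubset (f ∘ (false ∷_)) ⊓ minSubset (f ∘ (true ∷_))

minSubset-≤ : ∀ (f : Subset n → ℕ) Y → minSubset f ≤ f Y
minSubset-≤ f []          = ≤-refl
minSubset-≤ f (false ∷ Y) = ≤-trans (m⊓n≤m _ _) (minSubset-≤ (f ∘ (false ∷_)) Y)
minSubset-≤ f (true  ∷ Y) = ≤-trans (m⊓n≤n _ _) (minSubset-≤ (f ∘ (true ∷_)) Y)

minSubset-attained : ∀ (f : Subset n → ℕ) → ∃ λ Y → minSubset f ≡ f Y
minSubset-attained {zero}  f = [] , refl
minSubset-attained {suc n} f
  with minSubset-attained (f ∘ (false ∷_)) | minSubset-attained (f ∘ (true ∷_))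
     | ⊓-sel (minSubset (f ∘ (false ∷_))) (minSubset (f ∘ (true ∷_)))
... | Y , eq | _ | inj₁ min≡ˡ = false ∷ Y , trans min≡ˡ eq
... | _ | Y , eq | inj₂ min≡ʳ = true ∷ Y , trans min≡ʳ eq

≤-minSubset : ∀ {c} (f : Subset n → ℕ) → (∀ Y → c ≤ f Y) → c ≤ minSubset f
≤-minSubset f c≤f with minSubset-attained f
... | Y , eq = ≤-trans (c≤f Y) (≤-reflexive (sym eq))

minSubset-cong : ∀ {f g : Subset n → ℕ} → (∀ Y → f Y ≡ g Y) → minSubset f ≡ minSubset g
minSubset-cong {f = f} {g} f≗g =
  ≤-antisym (≤-minSubset g (λ Y → ≤-trans (minSubset-≤ f Y) (≤-reflexive (f≗g Y))))
            (≤-minSubset f (λ Y → ≤-trans (minSubset-≤ g Y) (≤-reflexive (sym (f≗g Y)))))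

-- Matroid basics

module _ (M : Matroid n) where

  rank-subadditive : ∀ P Q → rank M (P ∪ Q) ≤ rank M P + rank M Q
  rank-subadditive P Q = ≤-trans (m≤m+n _ _) (rank-submod M P Q)

  rank-≤-rank+∣─∣ : ∀ X Z → rank M X ≤ rank M Z + ∣ X ─ Z ∣
  rank-≤-rank+∣─∣ X Z = begin
    rank M X                       ≤⟨ rank-mono M X⊆Z∪X─Z ⟩
    rank M (Z ∪ (X ─ Z))           ≤⟨ rank-subadditive Z (X ─ Z) ⟩
    rank M Z + rank M (X ─ Z)      ≤⟨ +-monoʳ-≤ (rank M Z) (rank-≤-card M (X ─ Z)) ⟩
    rank M Z + ∣ X ─ Z ∣           ∎
    where
    open ≤-Reasoning
    X⊆Z∪X─Z : X ⊆ Z ∪ (X ─ Z)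
    X⊆Z∪X─Z {x} x∈X with x ∈? Z
    ... | yes x∈Z = x∈p∪q⁺ (inj₁ x∈Z)
    ... | no  x∉Z = x∈p∪q⁺ (inj₂ (x∈p∧x∉q⇒x∈p─q x∈X x∉Z))

  rank-∪-≤ : ∀ P Q → rank M (P ∪ Q) ≤ rank M P + ∣ Q ─ P ∣
  rank-∪-≤ P Q = ≤-trans (rank-≤-rank+∣─∣ (P ∪ Q) P) (+-monoʳ-≤ (rank M P) (p⊆q⇒∣p∣≤∣q∣ P∪Q─P⊆Q─P))
    where
    P∪Q─P⊆Q─P : (P ∪ Q) ─ P ⊆ Q ─ P
    P∪Q─P⊆Q─P x∈ with x∈p∪q⁻ P Q (p─q⊆p (P ∪ Q) P x∈)
    ... | inj₁ x∈P = contradiction x∈P (x∈p─q⇒x∉q x∈)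
    ... | inj₂ x∈Q = x∈p∧x∉q⇒x∈p─q x∈Q (x∈p─q⇒x∉q x∈)

  Indep-⊆ : ∀ {I J} → Indep M I → J ⊆ I → Indep M J
  Indep-⊆ {I} {J} indep J⊆I = ≤-antisym (rank-≤-card M J) (+-cancelʳ-≤ ∣ I ─ J ∣ _ _ (begin
    ∣ J ∣ + ∣ I ─ J ∣              ≡⟨ cong (λ S → ∣ S ∣ + ∣ I ─ J ∣) I∩J≡J ⟨
    ∣ I ∩ J ∣ + ∣ I ─ J ∣          ≡⟨ ∣p∣≡∣p∩q∣+∣p─q∣ I J ⟨
    ∣ I ∣                          ≡⟨ indep ⟨
    rank M I                       ≤⟨ rank-≤-rank+∣─∣ I J ⟩
    rank M J + ∣ I ─ J ∣           ∎))
    where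
    open ≤-Reasoning
    I∩J≡J : I ∩ J ≡ J
    I∩J≡J = ⊆-antisym (p∩q⊆q I J) (λ x∈J → x∈p∩q⁺ (J⊆I x∈J , x∈J))

  all-deletions-drop⇒Indep : ∀ W → (∀ {e} → e ∈ W → rank M (W - e) < rank M W) → Indep M W
  all-deletions-drop⇒Indep W drop = ≤-antisym (rank-≤-card M W) (go W (<-wellFounded ∣ W ∣) drop)
    where
    go : ∀ W → Acc _<_ ∣ W ∣ → (∀ {e} → e ∈ W → rank M (W - e) < rank M W) → ∣ W ∣ ≤ rank M W
    go W (acc rs) drop with nonempty? W
    ... | no  empty    = ≤-trans (≤-reflexive (Empty⇒∣∣≡0 empty)) z≤n
    ... | yes (e , e∈W) = begin
      ∣ W ∣              ≡⟨ suc∣p-x∣≡∣p∣ e∈W ⟨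
      suc ∣ W - e ∣      ≤⟨ s≤s (go (W - e) (rs (x∈p⇒∣p-x∣<∣p∣ e∈W)) drop′) ⟩
      suc (rank M (W - e)) ≤⟨ drop e∈W ⟩
      rank M W           ∎
      where
      open ≤-Reasoning
      V = W - e
      drop′ : ∀ {f} → f ∈ V → rank M (V - f) < rank M V
      drop′ {f} f∈V = +-cancelˡ-< (rank M W) _ _ (begin-strict
        rank M W + rank M (V - f)                    ≤⟨ +-mono-≤ (rank-mono M W⊆) (rank-mono M V-f⊆) ⟩
        rank M (V ∪ (W - f)) + rank M (V ∩ (W - f))  ≤⟨ rank-submod M V (W - f) ⟩
        rank M V + rank M (W - f)                    <⟨ +-monoʳ-< (rank M V) (drop f∈W) ⟩
        rank M V + rank M W                          ≡⟨ +-comm (rank M V) (rank M W) ⟩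
        rank M W + rank M V                          ∎)
        where
        f∈W : f ∈ W
        f∈W = p─q⊆p W ⁅ e ⁆ f∈V
        W⊆ : W ⊆ V ∪ (W - f)
        W⊆ {x} x∈W with x ≟ᶠ e
        ... | yes refl = x∈p∪q⁺ (inj₂ (x∈p∧x≢y⇒x∈p-y x∈W (λ x≡f → x∈p-y⇒x≢y f∈V (sym x≡f))))
        ... | no  x≢e  = x∈p∪q⁺ (inj₁ (x∈p∧x≢y⇒x∈p-y x∈W x≢e))
        V-f⊆ : V - f ⊆ V ∩ (W - f)
        V-f⊆ x∈V-f = let x∈V = p─q⊆p V ⁅ f ⁆ x∈V-f in
          x∈p∩q⁺ (x∈V , x∈p∧x≢y⇒x∈p-y (p─q⊆p W ⁅ e ⁆ x∈V) (x∈p-y⇒x≢y x∈V-f))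

  ∃-maximal-Indep : ∀ W → ∃ λ I → I ⊆ W × Indep M I × rank M W ≤ ∣ I ∣
  ∃-maximal-Indep W = go W (<-wellFounded ∣ W ∣)
    where
    go : ∀ W → Acc _<_ ∣ W ∣ → ∃ λ I → I ⊆ W × Indep M I × rank M W ≤ ∣ I ∣
    go W (acc rs) with any? (λ e → e ∈? W ×-dec rank M W ≤? rank M (W - e))
    ... | yes (e , e∈W , no-drop) with go (W - e) (rs (x∈p⇒∣p-x∣<∣p∣ e∈W))
    ...   | I , I⊆W-e , indep , rW-e≤∣I∣ = I , p─q⊆p W ⁅ e ⁆ ∘ I⊆W-e , indep , ≤-trans no-drop rW-e≤∣I∣
    go W (acc rs) | no all-drop = W , ⊆-refl , indep , rank-≤-card M W
      where
      indep : Indep M W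
      indep = all-deletions-drop⇒Indep W (λ {e} e∈W → ≰⇒> (λ no-drop → all-drop (e , e∈W , no-drop)))

  ∃-cyclic-below : ∀ X → ∃ λ Z → IsCyclic M Z × rank M Z + ∣ X ─ Z ∣ ≤ rank M X
  ∃-cyclic-below X = go X (<-wellFounded ∣ X ∣) (≤-reflexive (trans (cong (rank M X +_) (∣p─p∣≡0 X)) (+-identityʳ _)))
    where
    go : ∀ Z → Acc _<_ ∣ Z ∣ → rank M Z + ∣ X ─ Z ∣ ≤ rank M X →
         ∃ λ Z → IsCyclic M Z × rank M Z + ∣ X ─ Z ∣ ≤ rank M X
    go Z (acc rs) inv with any? (λ e → e ∈? Z ×-dec rank M (Z - e) <? rank M Z)
    ... | no no-coloop = Z , cyclic , inv
      where
      cyclic : IsCyclic M Z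
      cyclic e e∈Z = ≤-antisym (rank-mono M (p─q⊆p Z ⁅ e ⁆)) (≮⇒≥ (λ coloop → no-coloop (e , e∈Z , coloop)))
    ... | yes (e , e∈Z , coloop) = go (Z - e) (rs (x∈p⇒∣p-x∣<∣p∣ e∈Z)) (begin
      rank M (Z - e) + ∣ X ─ (Z - e) ∣   ≤⟨ +-monoʳ-≤ (rank M (Z - e)) ∣X─Z-e∣≤ ⟩
      rank M (Z - e) + (∣ X ─ Z ∣ + 1)   ≡⟨ cong (rank M (Z - e) +_) (+-comm _ 1) ⟩
      rank M (Z - e) + suc ∣ X ─ Z ∣     ≡⟨ +-suc _ _ ⟩
      suc (rank M (Z - e)) + ∣ X ─ Z ∣   ≤⟨ +-monoˡ-≤ ∣ X ─ Z ∣ coloop ⟩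
      rank M Z + ∣ X ─ Z ∣               ≤⟨ inv ⟩
      rank M X                           ∎)
      where
      open ≤-Reasoning
      ⊆X─Z∪e : X ─ (Z - e) ⊆ (X ─ Z) ∪ ⁅ e ⁆
      ⊆X─Z∪e {x} x∈ with x ≟ᶠ e
      ... | yes refl = x∈p∪q⁺ (inj₂ (x∈⁅x⁆ e))
      ... | no  x≢e  = x∈p∪q⁺ (inj₁ (x∈p∧x∉q⇒x∈p─q (p─q⊆p X (Z - e) x∈)
                                       (λ x∈Z → x∈p─q⇒x∉q x∈ (x∈p∧x≢y⇒x∈p-y x∈Z x≢e))))
      ∣X─Z-e∣≤ : ∣ X ─ (Z - e) ∣ ≤ ∣ X ─ Z ∣ + 1
      ∣X─Z-e∣≤ = ≤-trans (p⊆q⇒∣p∣≤∣q∣ ⊆X─Z∪e)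
                  (≤-trans (∣p∪q∣≤∣p∣+∣q∣ (X ─ Z) ⁅ e ⁆) (≤-reflexive (cong (∣ X ─ Z ∣ +_) (∣⁅x⁆∣≡1 e))))

  ∃-cyclicFlat-above : ∀ Z → IsCyclic M Z → ∃ λ F → IsCyclicFlat M F × Z ⊆ F × rank M F ≤ rank M Z
  ∃-cyclicFlat-above Z = go Z (<-wellFounded (n ∸ ∣ Z ∣))
    where
    go : ∀ Z → Acc _<_ (n ∸ ∣ Z ∣) → IsCyclic M Z → ∃ λ F → IsCyclicFlat M F × Z ⊆ F × rank M F ≤ rank M Z
    go Z (acc rs) cyclic with any? (λ e → ¬? (e ∈? Z) ×-dec rank M (Z ∪ ⁅ e ⁆) ≤? rank M Z)
    ... | no all-rise = Z , (flat , cyclic) , ⊆-refl , ≤-refl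
      where
      flat : IsFlat M Z
      flat e e∉Z = ≰⇒> (λ no-rise → all-rise (e , e∉Z , no-rise))
    ... | yes (e , e∉Z , no-rise) with go (Z ∪ ⁅ e ⁆) (rs smaller) cyclic′
      where
      Z′ = Z ∪ ⁅ e ⁆
      smaller : n ∸ ∣ Z′ ∣ < n ∸ ∣ Z ∣
      smaller = ∸-monoʳ-< (≤-reflexive (sym (∣p∪⁅x⁆∣≡suc∣p∣ e∉Z))) (∣p∣≤n Z′)
      rZ′≡rZ : rank M Z′ ≡ rank M Z
      rZ′≡rZ = ≤-antisym no-rise (rank-mono M (p⊆p∪q ⁅ e ⁆))
      cyclic′ : IsCyclic M Z′
      cyclic′ f f∈Z′ with f ≟ᶠ e
      ... | yes refl = ≤-antisym (rank-mono M (p─q⊆p Z′ ⁅ f ⁆)) (begin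
        rank M Z′        ≡⟨ rZ′≡rZ ⟩
        rank M Z         ≤⟨ rank-mono M (λ x∈Z → x∈p∧x≢y⇒x∈p-y (x∈p∪q⁺ (inj₁ x∈Z)) (λ { refl → e∉Z x∈Z })) ⟩
        rank M (Z′ - f)  ∎)
        where open ≤-Reasoning
      ... | no f≢e = ≤-antisym (rank-mono M (p─q⊆p Z′ ⁅ f ⁆)) (begin
        rank M Z′        ≡⟨ rZ′≡rZ ⟩
        rank M Z         ≡⟨ cyclic f f∈Z ⟨
        rank M (Z - f)   ≤⟨ rank-mono M Z-f⊆Z′-f ⟩
        rank M (Z′ - f)  ∎)
        where
        open ≤-Reasoning
        Z-f⊆Z′-f : Z - f ⊆ Z′ - f
        Z-f⊆Z′-f x∈Z-f = x∈p∧x≢y⇒x∈p-y (p⊆p∪q ⁅ e ⁆ (p─q⊆p Z ⁅ f ⁆ x∈Z-f)) (x∈p-y⇒x≢y x∈Z-f)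
        f∈Z : f ∈ Z
        f∈Z with x∈p∪q⁻ Z ⁅ e ⁆ f∈Z′
        ... | inj₁ f∈Z   = f∈Z
        ... | inj₂ f∈⁅e⁆ = contradiction (x∈⁅y⁆⇒x≡y e f∈⁅e⁆) f≢e
    ... | F , cyclicFlat , Z′⊆F , rF≤rZ′ = F , cyclicFlat , Z′⊆F ∘ x∈p∪q⁺ ∘ inj₁ , ≤-trans rF≤rZ′ no-rise

  ∃-cyclicFlat-below : ∀ X → ∃ λ F → IsCyclicFlat M F × rank M F + ∣ X ─ F ∣ ≤ rank M X
  ∃-cyclicFlat-below X with ∃-cyclic-below X
  ... | Z , cyclic , rZ+∣X─Z∣≤rX with ∃-cyclicFlat-above Z cyclic
  ...   | F , cyclicFlat , Z⊆F , rF≤rZ =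
    F , cyclicFlat , ≤-trans (+-mono-≤ rF≤rZ (p⊆q⇒∣p∣≤∣q∣ (p∩r⊆q⇒p─q⊆p─r (Z⊆F ∘ p∩q⊆q X Z)))) rZ+∣X─Z∣≤rX

Indep⇒rank≤ : (M M′ : Matroid n) → (∀ X → Indep M X → Indep M′ X) → ∀ W → rank M W ≤ rank M′ W
Indep⇒rank≤ M M′ M⇒M′ W with ∃-maximal-Indep M W
... | I , I⊆W , indep , rW≤∣I∣ = ≤-trans rW≤∣I∣ (≤-trans (≤-reflexive (sym (M⇒M′ I indep))) (rank-mono M′ I⊆W))

Indep⇔⇒rank≡ : (M M′ : Matroid n) → (∀ X → Indep M X ⇔ Indep M′ X) → ∀ W → rank M W ≡ rank M′ W
Indep⇔⇒rank≡ M M′ same W =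
  ≤-antisym (Indep⇒rank≤ M M′ (Equivalence.to ∘ same) W) (Indep⇒rank≤ M′ M (Equivalence.from ∘ same) W)

-- Matroids of rank one

nonloops : Matroid n → Subset n
nonloops M = tabulate (λ x → does (rank M ⁅ x ⁆ ≟ 1))

∈-nonloops⁻ : ∀ (M : Matroid n) {x} → x ∈ nonloops M → rank M ⁅ x ⁆ ≡ 1
∈-nonloops⁻ M {x} x∈ =
  does⇒ (rank M ⁅ x ⁆ ≟ 1) (trans (sym (lookup∘tabulate (λ y → does (rank M ⁅ y ⁆ ≟ 1)) x)) ([]=⇒lookup x∈))

∈-nonloops⁺ : ∀ (M : Matroid n) {x} → rank M ⁅ x ⁆ ≡ 1 → x ∈ nonloops M
∈-nonloops⁺ M {x} r≡1 =
  lookup⇒[]= x (nonloops M) (trans (lookup∘tabulate (λ y → does (rank M ⁅ y ⁆ ≟ 1)) x) (dec-true (rank M ⁅ x ⁆ ≟ 1) r≡1))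

module _ (M : Matroid n) (rank⊤≤1 : rank M ⊤ ≤ 1) where

  Indep⇔⊆nonloops : ∀ I → Indep M I ⇔ (I ⊆ nonloops M × ∣ I ∣ ≤ 1)
  Indep⇔⊆nonloops I = mk⇔ to from
    where
    to : Indep M I → I ⊆ nonloops M × ∣ I ∣ ≤ 1
    to indep = (λ {y} y∈I → ∈-nonloops⁺ M (trans (Indep-⊆ M indep (x∈p⇒⁅x⁆⊆p y∈I)) (∣⁅x⁆∣≡1 y)))
             , ≤-trans (≤-reflexive (sym indep)) (≤-trans (rank-mono M (λ _ → ∈⊤)) rank⊤≤1)
    from : I ⊆ nonloops M × ∣ I ∣ ≤ 1 → Indep M I
    from (I⊆ , ∣I∣≤1) with nonempty? I
    ... | no empty = trans (n≤0⇒n≡0 (≤-trans (rank-≤-card M I) (≤-reflexive ∣I∣≡0))) (sym ∣I∣≡0)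
      where ∣I∣≡0 = Empty⇒∣∣≡0 empty
    ... | yes (y , y∈I) = ≤-antisym (rank-≤-card M I)
      (≤-trans ∣I∣≤1 (≤-trans (≤-reflexive (sym (∈-nonloops⁻ M (I⊆ y∈I)))) (rank-mono M (x∈p⇒⁅x⁆⊆p y∈I))))

rank⊤≡1⇒∃nonloop : ∀ (M : Matroid n) → rank M ⊤ ≡ 1 → ∃ λ x → x ∈ nonloops M
rank⊤≡1⇒∃nonloop M rank⊤≡1 with ∃-maximal-Indep M ⊤
... | I , _ , indep , r⊤≤∣I∣ with nonempty? I
...   | yes (x , x∈I) = x , proj₁ (Equivalence.to (Indep⇔⊆nonloops M (≤-reflexive rank⊤≡1) I) indep) x∈I
...   | no  empty     =
  contradiction (trans (sym rank⊤≡1) (n≤0⇒n≡0 (≤-trans r⊤≤∣I∣ (≤-reflexive (Empty⇒∣∣≡0 empty))))) λ ()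

rankOne : Subset n → Matroid n
rankOne A₀ = record
  { rank        = λ X → 𝟙 (nonempty? (A₀ ∩ X))
  ; rank-≤-card = ≤-card
  ; rank-mono   = λ {X} {Y} X⊆Y → 𝟙-mono (nonempty? (A₀ ∩ X)) (nonempty? (A₀ ∩ Y)) (meets-mono X⊆Y)
  ; rank-submod = λ X Y → 𝟙-submodular (nonempty? (A₀ ∩ X)) (nonempty? (A₀ ∩ Y))
                    (nonempty? (A₀ ∩ (X ∪ Y))) (nonempty? (A₀ ∩ (X ∩ Y))) (meets-∪ X Y) (meets-∩ X Y)
  }
  where
  split : ∀ {X x} → x ∈ A₀ ∩ X → x ∈ A₀ × x ∈ X
  split = x∈p∩q⁻ A₀ _
  ≤-card : ∀ X → 𝟙 (nonempty? (A₀ ∩ X)) ≤ ∣ X ∣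
  ≤-card X with nonempty? (A₀ ∩ X)
  ... | yes (x , x∈) = ∈⇒0<∣∣ (proj₂ (split x∈))
  ... | no _         = z≤n
  meets-mono : ∀ {X Y} → X ⊆ Y → Nonempty (A₀ ∩ X) → Nonempty (A₀ ∩ Y)
  meets-mono X⊆Y (x , x∈) = x , x∈p∩q⁺ (proj₁ (split x∈) , X⊆Y (proj₂ (split x∈)))
  meets-∪ : ∀ X Y → Nonempty (A₀ ∩ (X ∪ Y)) → Nonempty (A₀ ∩ X) ⊎ Nonempty (A₀ ∩ Y)
  meets-∪ X Y (x , x∈) with x∈p∪q⁻ X Y (proj₂ (split x∈))
  ... | inj₁ x∈X = inj₁ (x , x∈p∩q⁺ (proj₁ (split x∈) , x∈X))
  ... | inj₂ x∈Y = inj₂ (x , x∈p∩q⁺ (proj₁ (split x∈) , x∈Y))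
  meets-∩ : ∀ X Y → Nonempty (A₀ ∩ (X ∩ Y)) → Nonempty (A₀ ∩ X) × Nonempty (A₀ ∩ Y)
  meets-∩ X Y (x , x∈) = meets-mono (p∩q⊆p X Y) (x , x∈) , meets-mono (p∩q⊆q X Y) (x , x∈)

rankOne-Indep⇔ : ∀ (A₀ I : Subset n) → Indep (rankOne A₀) I ⇔ (I ⊆ A₀ × ∣ I ∣ ≤ 1)
rankOne-Indep⇔ {n} A₀ I = mk⇔
  (λ indep → let (I⊆ , ∣I∣≤1) = Equivalence.to (Indep⇔⊆nonloops U rank⊤≤1 I) indep
             in (λ {x} x∈I → nonloop⇒∈ (I⊆ x∈I)) , ∣I∣≤1)
  (λ (I⊆A₀ , ∣I∣≤1) → Equivalence.from (Indep⇔⊆nonloops U rank⊤≤1 I)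
                        ((λ {x} x∈I → ∈⇒nonloop (I⊆A₀ x∈I)) , ∣I∣≤1))
  where
  U : Matroid n
  U = rankOne A₀
  rank⊤≤1 : rank U ⊤ ≤ 1
  rank⊤≤1 = 𝟙≤1 (nonempty? (A₀ ∩ ⊤))
  nonloop⇒∈ : ∀ {x} → x ∈ nonloops U → x ∈ A₀
  nonloop⇒∈ {x} x∈ with nonempty? (A₀ ∩ ⁅ x ⁆) | ∈-nonloops⁻ U x∈
  ... | yes (y , y∈) | _ = let (y∈A₀ , y∈⁅x⁆) = x∈p∩q⁻ A₀ ⁅ x ⁆ y∈ in subst (_∈ A₀) (x∈⁅y⁆⇒x≡y x y∈⁅x⁆) y∈A₀
  ... | no _ | ()
  ∈⇒nonloop : ∀ {x} → x ∈ A₀ → x ∈ nonloops U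
  ∈⇒nonloop {x} x∈A₀ = ∈-nonloops⁺ U (𝟙-yes (nonempty? (A₀ ∩ ⁅ x ⁆)) (x , x∈p∩q⁺ (x∈A₀ , x∈⁅x⁆ x)))

-- Hall's theorem

rankOne-≤ : ∀ {A₀ B₀ : Subset n} Y → (Nonempty (A₀ ∩ Y) → Nonempty (B₀ ∩ Y)) →
            rank (rankOne A₀) Y ≤ rank (rankOne B₀) Y
rankOne-≤ {A₀ = A₀} {B₀} Y = 𝟙-mono (nonempty? (A₀ ∩ Y)) (nonempty? (B₀ ∩ Y))

#meeting : (Fin k → Subset m) → Subset m → ℕ
#meeting {k} A Y = ∑[ i < k ] rank (rankOne (A i)) Y

#meeting-mono : ∀ (A : Fin k → Subset m) {X Y} → X ⊆ Y → #meeting A X ≤ #meeting A Y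
#meeting-mono A X⊆Y = ∑-mono-≤ (λ i → rank-mono (rankOne (A i)) X⊆Y)

#meeting-submod : ∀ (A : Fin k → Subset m) X Y → #meeting A (X ∪ Y) + #meeting A (X ∩ Y) ≤ #meeting A X + #meeting A Y
#meeting-submod A X Y = ∑-mono-≤₂ (λ i → rank-submod (rankOne (A i)) X Y)

HallCondition : (Fin k → Subset m) → Subset m → Set
HallCondition A X = ∀ Y → Y ⊆ X → ∣ Y ∣ ≤ #meeting A Y

IsPartialTransversal : (Fin k → Subset m) → Subset m → Set
IsPartialTransversal {k} {m} A X = Σ (Fin k → Subset m) λ I → (∀ i → I i ⊆ A i × ∣ I i ∣ ≤ 1) × X ≡ ⋃ I

IsPartialTransversal-mono : ∀ {A B : Fin k → Subset m} {X} → (∀ i → B i ⊆ A i) →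
                            IsPartialTransversal B X → IsPartialTransversal A X
IsPartialTransversal-mono B⊆A (I , small , X≡⋃I) = I , (λ i → B⊆A i ∘ proj₁ (small i) , proj₂ (small i)) , X≡⋃I

IsPartialTransversal-⊆ : ∀ {A : Fin k → Subset m} {X Y} → IsPartialTransversal A X → Y ⊆ X → IsPartialTransversal A Y
IsPartialTransversal-⊆ {Y = Y} (I , small , refl) Y⊆⋃I =
  (λ i → I i ∩ Y) , (λ i → proj₁ (small i) ∘ p∩q⊆p (I i) Y , ≤-trans (∣p∩q∣≤∣p∣ (I i) Y) (proj₂ (small i))) ,
  ⊆-antisym Y⊆⋃I∩Y ⋃I∩Y⊆Y
  where
  Y⊆⋃I∩Y : Y ⊆ ⋃ (λ i → I i ∩ Y)
  Y⊆⋃I∩Y y∈Y with ∈-⋃⁻ I (Y⊆⋃I y∈Y)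
  ... | i , y∈Iᵢ = ∈-⋃⁺ (λ i → I i ∩ Y) i (x∈p∩q⁺ (y∈Iᵢ , y∈Y))
  ⋃I∩Y⊆Y : ⋃ (λ i → I i ∩ Y) ⊆ Y
  ⋃I∩Y⊆Y y∈ with ∈-⋃⁻ (λ i → I i ∩ Y) y∈
  ... | i , y∈Iᵢ∩Y = p∩q⊆q (I i) Y y∈Iᵢ∩Y

IsPartialTransversal⇒∣∣≤ : ∀ {A : Fin k → Subset m} {X} → IsPartialTransversal A X → ∣ X ∣ ≤ #meeting A X
IsPartialTransversal⇒∣∣≤ {k} {A = A} (I , small , refl) = ≤-trans (∣⋃∣≤∑ I) (∑-mono-≤ ∣Iᵢ∣≤)
  where
  ∣Iᵢ∣≤ : ∀ i → ∣ I i ∣ ≤ rank (rankOne (A i)) (⋃ I)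
  ∣Iᵢ∣≤ i with nonempty? (I i)
  ... | no empty = ≤-trans (≤-reflexive (Empty⇒∣∣≡0 empty)) z≤n
  ... | yes (x , x∈Iᵢ) = ≤-trans (proj₂ (small i))
    (≤-reflexive (sym (𝟙-yes (nonempty? (A i ∩ ⋃ I)) (x , x∈p∩q⁺ (proj₁ (small i) x∈Iᵢ , ∈-⋃⁺ I i x∈Iᵢ)))))

IsPartialTransversal⇒Hall : ∀ {A : Fin k → Subset m} {X} → IsPartialTransversal A X → HallCondition A X
IsPartialTransversal⇒Hall pt Y Y⊆X = IsPartialTransversal⇒∣∣≤ (IsPartialTransversal-⊆ pt Y⊆X)

hall-or-violator : ∀ (A : Fin k → Subset m) X → HallCondition A X ⊎ ∃ λ Y → Y ⊆ X × #meeting A Y < ∣ Y ∣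
hall-or-violator A X with anySubset? (λ Y → Y ⊆? X ×-dec #meeting A Y <? ∣ Y ∣)
... | yes violator    = inj₂ violator
... | no  no-violator = inj₁ (λ Y Y⊆X → ≮⇒≥ (λ violates → no-violator (Y , Y⊆X , violates)))

deleteFrom : (Fin k → Subset m) → Fin k → Fin m → Fin k → Subset m
deleteFrom A i x = updateAt A i (_- x)

deleteFrom-⊆ : ∀ (A : Fin k → Subset m) i x j → deleteFrom A i x j ⊆ A j
deleteFrom-⊆ A i x j with j ≟ᶠ i
... | yes refl rewrite updateAt-updates j {_- x} A = p─q⊆p (A j) ⁅ x ⁆
... | no  j≢i  rewrite updateAt-minimal j i {_- x} A j≢i = ⊆-refl

∈-deleteFrom : ∀ (A : Fin k → Subset m) {i x j y} → y ∈ A j → (j ≡ i → y ≢ x) → y ∈ deleteFrom A i x j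
∈-deleteFrom A {i} {x} {j} y∈Aⱼ allowed with j ≟ᶠ i
... | yes refl rewrite updateAt-updates j {_- x} A = x∈p∧x≢y⇒x∈p-y y∈Aⱼ (allowed refl)
... | no  j≢i  rewrite updateAt-minimal j i {_- x} A j≢i = y∈Aⱼ

familySize : (Fin k → Subset m) → ℕ
familySize {k} A = ∑[ i < k ] ∣ A i ∣

familySize-deleteFrom : ∀ (A : Fin k → Subset m) {i x} → x ∈ A i → familySize (deleteFrom A i x) < familySize A
familySize-deleteFrom A {i} {x} x∈Aᵢ = ∑-mono-< i (λ j → p⊆q⇒∣p∣≤∣q∣ (deleteFrom-⊆ A i x j))
  (subst (λ S → ∣ S ∣ < ∣ A i ∣) (sym (updateAt-updates i {_- x} A)) (x∈p⇒∣p-x∣<∣p∣ x∈Aᵢ))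

#meeting-deleteFrom-exchange : ∀ (A : Fin k → Subset m) {x i₁ i₂ Y₁ Y₂} → i₁ ≢ i₂ → x ∈ Y₁ ∩ Y₂ →
  #meeting A (Y₁ ∪ Y₂) + #meeting A ((Y₁ ∩ Y₂) - x) ≤
  #meeting (deleteFrom A i₁ x) Y₁ + #meeting (deleteFrom A i₂ x) Y₂
#meeting-deleteFrom-exchange A {x} {i₁} {i₂} {Y₁} {Y₂} i₁≢i₂ x∈Y₁∩Y₂ = ∑-mono-≤₂ λ j →
  𝟙-submodular (nonempty? (A₁ j ∩ Y₁)) (nonempty? (A₂ j ∩ Y₂)) (nonempty? (A j ∩ U)) (nonempty? (A j ∩ V))
               (meets-U j) (meets-V j)
  where
  A₁ = deleteFrom A i₁ x
  A₂ = deleteFrom A i₂ x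
  U = Y₁ ∪ Y₂
  V = (Y₁ ∩ Y₂) - x
  meet : ∀ {B : Fin k → Subset m} {j Y y} → y ∈ B j → y ∈ Y → Nonempty (B j ∩ Y)
  meet y∈Bⱼ y∈Y = _ , x∈p∩q⁺ (y∈Bⱼ , y∈Y)
  -- x itself still lies in whichever of A₁ j, A₂ j it was not deleted from
  meets-U : ∀ j → Nonempty (A j ∩ U) → Nonempty (A₁ j ∩ Y₁) ⊎ Nonempty (A₂ j ∩ Y₂)
  meets-U j (y , y∈) with x∈p∩q⁻ (A j) U y∈
  ... | y∈Aⱼ , y∈U with y ≟ᶠ x | x∈p∪q⁻ Y₁ Y₂ y∈U
  ...   | no y≢x | inj₁ y∈Y₁ = inj₁ (meet {B = A₁} (∈-deleteFrom A y∈Aⱼ (λ _ → y≢x)) y∈Y₁)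
  ...   | no y≢x | inj₂ y∈Y₂ = inj₂ (meet {B = A₂} (∈-deleteFrom A y∈Aⱼ (λ _ → y≢x)) y∈Y₂)
  ...   | yes refl | _ with j ≟ᶠ i₁
  ...     | no  j≢i₁ = inj₁ (meet {B = A₁} (∈-deleteFrom A y∈Aⱼ (⊥-elim ∘ j≢i₁)) (p∩q⊆p Y₁ Y₂ x∈Y₁∩Y₂))
  ...     | yes refl = inj₂ (meet {B = A₂} (∈-deleteFrom A y∈Aⱼ (⊥-elim ∘ i₁≢i₂)) (p∩q⊆q Y₁ Y₂ x∈Y₁∩Y₂))
  meets-V : ∀ j → Nonempty (A j ∩ V) → Nonempty (A₁ j ∩ Y₁) × Nonempty (A₂ j ∩ Y₂)
  meets-V j (y , y∈) with x∈p∩q⁻ (A j) V y∈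
  ... | y∈Aⱼ , y∈V with x∈p∩q⁻ Y₁ Y₂ (p─q⊆p (Y₁ ∩ Y₂) ⁅ x ⁆ y∈V)
  ...   | y∈Y₁ , y∈Y₂ = meet {B = A₁} (∈-deleteFrom A y∈Aⱼ (λ _ → x∈p-y⇒x≢y y∈V)) y∈Y₁
                      , meet {B = A₂} (∈-deleteFrom A y∈Aⱼ (λ _ → x∈p-y⇒x≢y y∈V)) y∈Y₂

module _ {A : Fin k → Subset m} {X : Subset m} (hall : HallCondition A X) where

  violator-∋ : ∀ {i x Y} → Y ⊆ X → #meeting (deleteFrom A i x) Y < ∣ Y ∣ → x ∈ Y
  violator-∋ {i} {x} {Y} Y⊆X violates with x ∈? Y
  ... | yes x∈Y = x∈Y
  ... | no  x∉Y = contradiction (≤-trans (hall Y Y⊆X) (∑-mono-≤ still-meets)) (<⇒≱ violates)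
    where
    still-meets : ∀ j → rank (rankOne (A j)) Y ≤ rank (rankOne (deleteFrom A i x j)) Y
    still-meets j = rankOne-≤ Y λ (y , y∈) → let (y∈Aⱼ , y∈Y) = x∈p∩q⁻ (A j) Y y∈ in
      y , x∈p∩q⁺ (∈-deleteFrom A y∈Aⱼ (λ _ y≡x → x∉Y (subst (_∈ Y) y≡x y∈Y)) , y∈Y)

  HallCondition-deleteFrom : ∀ {x i₁ i₂} → i₁ ≢ i₂ →
                             HallCondition (deleteFrom A i₁ x) X ⊎ HallCondition (deleteFrom A i₂ x) X
  HallCondition-deleteFrom {x} {i₁} {i₂} i₁≢i₂
    with hall-or-violator (deleteFrom A i₁ x) X | hall-or-violator (deleteFrom A i₂ x) X
  ... | inj₁ hall₁ | _          = inj₁ hall₁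
  ... | inj₂ _     | inj₁ hall₂ = inj₂ hall₂
  ... | inj₂ (Y₁ , Y₁⊆X , v₁) | inj₂ (Y₂ , Y₂⊆X , v₂) = contradiction ≤-refl (<⇒≱ (begin-strict
    suc (#₁ + #₂)                     <⟨ s≤s (≤-reflexive (sym (+-suc #₁ #₂))) ⟩
    suc #₁ + suc #₂                   ≤⟨ +-mono-≤ v₁ v₂ ⟩
    ∣ Y₁ ∣ + ∣ Y₂ ∣                   ≡⟨ ∣p∪q∣+∣p∩q∣≡∣p∣+∣q∣ Y₁ Y₂ ⟨
    ∣ U ∣ + ∣ Y₁ ∩ Y₂ ∣               ≡⟨ cong (∣ U ∣ +_) (suc∣p-x∣≡∣p∣ x∈Y₁∩Y₂) ⟨
    ∣ U ∣ + suc ∣ V ∣                 ≤⟨ +-mono-≤ (hall U U⊆X) (s≤s (hall V V⊆X)) ⟩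
    #meeting A U + suc (#meeting A V) ≡⟨ +-suc _ _ ⟩
    suc (#meeting A U + #meeting A V) ≤⟨ s≤s (#meeting-deleteFrom-exchange A i₁≢i₂ x∈Y₁∩Y₂) ⟩
    suc (#₁ + #₂)                     ∎))
    where
    open ≤-Reasoning
    A₁ = deleteFrom A i₁ x
    A₂ = deleteFrom A i₂ x
    #₁ = #meeting A₁ Y₁
    #₂ = #meeting A₂ Y₂
    U = Y₁ ∪ Y₂
    V = (Y₁ ∩ Y₂) - x
    x∈Y₁∩Y₂ : x ∈ Y₁ ∩ Y₂
    x∈Y₁∩Y₂ = x∈p∩q⁺ (violator-∋ Y₁⊆X v₁ , violator-∋ Y₂⊆X v₂)
    U⊆X : U ⊆ X
    U⊆X y∈U = [ Y₁⊆X , Y₂⊆X ]′ (x∈p∪q⁻ Y₁ Y₂ y∈U)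
    V⊆X : V ⊆ X
    V⊆X = Y₁⊆X ∘ p∩q⊆p Y₁ Y₂ ∘ p─q⊆p (Y₁ ∩ Y₂) ⁅ x ⁆

  Hall⇒IsPartialTransversal-no-overlap : (∀ {x i j} → x ∈ X → x ∈ A i → x ∈ A j → i ≡ j) → IsPartialTransversal A X
  Hall⇒IsPartialTransversal-no-overlap unique =
    (λ i → A i ∩ X) , (λ i → p∩q⊆p (A i) X , ∣Aᵢ∩X∣≤1 i) , ⊆-antisym X⊆⋃ ⋃⊆X
    where
    ∣Aᵢ∩X∣≤1 : ∀ i → ∣ A i ∩ X ∣ ≤ 1
    ∣Aᵢ∩X∣≤1 i = ≤-trans (hall (A i ∩ X) (p∩q⊆q (A i) X))
      (≤-trans (∑-≤-single i only-i) (𝟙≤1 (nonempty? (A i ∩ (A i ∩ X)))))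
      where
      only-i : ∀ j → j ≢ i → rank (rankOne (A j)) (A i ∩ X) ≡ 0
      only-i j j≢i = 𝟙-no (nonempty? (A j ∩ (A i ∩ X))) λ (y , y∈) →
        let (y∈Aⱼ , y∈Aᵢ∩X) = x∈p∩q⁻ (A j) (A i ∩ X) y∈
            (y∈Aᵢ , y∈X)    = x∈p∩q⁻ (A i) X y∈Aᵢ∩X
        in j≢i (unique y∈X y∈Aⱼ y∈Aᵢ)
    X⊆⋃ : X ⊆ ⋃ (λ i → A i ∩ X)
    X⊆⋃ {x} x∈X with ∑-pos (≤-trans (≤-reflexive (sym (∣⁅x⁆∣≡1 x))) (hall ⁅ x ⁆ (x∈p⇒⁅x⁆⊆p x∈X)))
    ... | j , meets with 0<𝟙⇒ (nonempty? (A j ∩ ⁅ x ⁆)) meets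
    ...   | y , y∈ with x∈p∩q⁻ (A j) ⁅ x ⁆ y∈
    ...     | y∈Aⱼ , y∈⁅x⁆ rewrite x∈⁅y⁆⇒x≡y x y∈⁅x⁆ = ∈-⋃⁺ (λ i → A i ∩ X) j (x∈p∩q⁺ (y∈Aⱼ , x∈X))
    ⋃⊆X : ⋃ (λ i → A i ∩ X) ⊆ X
    ⋃⊆X x∈ with ∈-⋃⁻ (λ i → A i ∩ X) x∈
    ... | i , x∈Aᵢ∩X = p∩q⊆q (A i) X x∈Aᵢ∩X

-- Rado's proof: shrink the sets one element at a time, keeping Hall's condition, until no two meet inside X.
Hall⇒IsPartialTransversal : ∀ {A : Fin k → Subset m} {X} → HallCondition A X → IsPartialTransversal A X
Hall⇒IsPartialTransversal {k} {m} {A} {X} = go A (<-wellFounded (familySize A))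
  where
  go : ∀ A → Acc _<_ (familySize A) → HallCondition A X → IsPartialTransversal A X
  go A (acc rs) H with any? (λ x → x ∈? X ×-dec any? (λ i → any? (λ j → x ∈? A i ×-dec x ∈? A j ×-dec ¬? (i ≟ᶠ j))))
  ... | no no-overlap = Hall⇒IsPartialTransversal-no-overlap H unique
    where
    unique : ∀ {x i j} → x ∈ X → x ∈ A i → x ∈ A j → i ≡ j
    unique {x} {i} {j} x∈X x∈Aᵢ x∈Aⱼ with i ≟ᶠ j
    ... | yes i≡j = i≡j
    ... | no  i≢j = contradiction (x , x∈X , i , j , x∈Aᵢ , x∈Aⱼ , i≢j) no-overlap
  ... | yes (x , _ , i₁ , i₂ , x∈A₁ , x∈A₂ , i₁≢i₂) with HallCondition-deleteFrom H {x} i₁≢i₂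
  ...   | inj₁ H₁ = IsPartialTransversal-mono (deleteFrom-⊆ A i₁ x) (go _ (rs (familySize-deleteFrom A x∈A₁)) H₁)
  ...   | inj₂ H₂ = IsPartialTransversal-mono (deleteFrom-⊆ A i₂ x) (go _ (rs (familySize-deleteFrom A x∈A₂)) H₂)

-- Transversal matroids

∣─∣-submodular : ∀ (X₁ X₂ P Q : Subset n) →
                 ∣ (X₁ ∪ X₂) ─ (P ∪ Q) ∣ + ∣ (X₁ ∩ X₂) ─ (P ∩ Q) ∣ ≤ ∣ X₁ ─ P ∣ + ∣ X₂ ─ Q ∣
∣─∣-submodular X₁ X₂ P Q = ∣p∣+∣q∣≤∣r∣+∣s∣ _ _ _ _ ∪⊆∪ ∩⊆∩
  where
  ∪⊆∪ : ((X₁ ∪ X₂) ─ (P ∪ Q)) ∪ ((X₁ ∩ X₂) ─ (P ∩ Q)) ⊆ (X₁ ─ P) ∪ (X₂ ─ Q)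
  ∪⊆∪ {x} x∈ with x∈p∪q⁻ _ _ x∈
  ... | inj₁ x∈L₁ with x∈p∪q⁻ X₁ X₂ (p─q⊆p _ _ x∈L₁)
  ...   | inj₁ x∈X₁ = x∈p∪q⁺ (inj₁ (x∈p∧x∉q⇒x∈p─q x∈X₁ (x∈p─q⇒x∉q x∈L₁ ∘ x∈p∪q⁺ ∘ inj₁)))
  ...   | inj₂ x∈X₂ = x∈p∪q⁺ (inj₂ (x∈p∧x∉q⇒x∈p─q x∈X₂ (x∈p─q⇒x∉q x∈L₁ ∘ x∈p∪q⁺ ∘ inj₂)))
  ∪⊆∪ {x} x∈ | inj₂ x∈L₂ with x∈p∩q⁻ X₁ X₂ (p─q⊆p _ _ x∈L₂) | x ∈? P
  ...   | x∈X₁ , x∈X₂ | no  x∉P = x∈p∪q⁺ (inj₁ (x∈p∧x∉q⇒x∈p─q x∈X₁ x∉P))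
  ...   | x∈X₁ , x∈X₂ | yes x∈P =
    x∈p∪q⁺ (inj₂ (x∈p∧x∉q⇒x∈p─q x∈X₂ (λ x∈Q → x∈p─q⇒x∉q x∈L₂ (x∈p∩q⁺ (x∈P , x∈Q)))))
  ∩⊆∩ : ((X₁ ∪ X₂) ─ (P ∪ Q)) ∩ ((X₁ ∩ X₂) ─ (P ∩ Q)) ⊆ (X₁ ─ P) ∩ (X₂ ─ Q)
  ∩⊆∩ x∈ with x∈p∩q⁻ _ _ x∈
  ... | x∈L₁ , x∈L₂ with x∈p∩q⁻ X₁ X₂ (p─q⊆p _ _ x∈L₂)
  ...   | x∈X₁ , x∈X₂ = x∈p∩q⁺ ( x∈p∧x∉q⇒x∈p─q x∈X₁ (x∈p─q⇒x∉q x∈L₁ ∘ x∈p∪q⁺ ∘ inj₁)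
                               , x∈p∧x∉q⇒x∈p─q x∈X₂ (x∈p─q⇒x∉q x∈L₁ ∘ x∈p∪q⁺ ∘ inj₂))

module _ (A : Fin k → Subset m) where

  transversalRank : Subset m → ℕ
  transversalRank W = minSubset λ Y → ∣ W ─ Y ∣ + #meeting A (W ∩ Y)

  transversalRank-≤ : ∀ W Y → transversalRank W ≤ ∣ W ─ Y ∣ + #meeting A (W ∩ Y)
  transversalRank-≤ W = minSubset-≤ (λ Y → ∣ W ─ Y ∣ + #meeting A (W ∩ Y))

  transversalRank-attained : ∀ W → ∃ λ Y → transversalRank W ≡ ∣ W ─ Y ∣ + #meeting A (W ∩ Y)
  transversalRank-attained W = minSubset-attained (λ Y → ∣ W ─ Y ∣ + #meeting A (W ∩ Y))

  private
    ≤-card : ∀ W → transversalRank W ≤ ∣ W ∣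
    ≤-card W = begin
      transversalRank W
        ≤⟨ transversalRank-≤ W ⊥ ⟩
      ∣ W ─ ⊥ ∣ + #meeting A (W ∩ ⊥)
        ≡⟨ cong₂ _+_ (cong ∣_∣ (p─⊥≡p W)) (∑-zero (λ i → 𝟙-no (nonempty? (A i ∩ (W ∩ ⊥))) misses)) ⟩
      ∣ W ∣ + 0
        ≡⟨ +-identityʳ _ ⟩
      ∣ W ∣ ∎
      where
      open ≤-Reasoning
      misses : ∀ {B} → ¬ Nonempty (B ∩ (W ∩ ⊥))
      misses {B} (x , x∈) = ∉⊥ (p∩q⊆q W ⊥ (p∩q⊆q B (W ∩ ⊥) x∈))

    mono : ∀ {X W} → X ⊆ W → transversalRank X ≤ transversalRank W
    mono {X} {W} X⊆W with transversalRank-attained W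
    ... | Y , rW≡ = ≤-trans (transversalRank-≤ X Y) (≤-trans
      (+-mono-≤ (p⊆q⇒∣p∣≤∣q∣ (λ x∈ → x∈p∧x∉q⇒x∈p─q (X⊆W (p─q⊆p X Y x∈)) (x∈p─q⇒x∉q x∈)))
                (#meeting-mono A (λ x∈ → let (x∈X , x∈Y) = x∈p∩q⁻ X Y x∈ in x∈p∩q⁺ (X⊆W x∈X , x∈Y))))
      (≤-reflexive (sym rW≡)))

    submod : ∀ X₁ X₂ →
             transversalRank (X₁ ∪ X₂) + transversalRank (X₁ ∩ X₂) ≤ transversalRank X₁ + transversalRank X₂
    submod X₁ X₂ with transversalRank-attained X₁ | transversalRank-attained X₂
    ... | Y₁ , r₁≡ | Y₂ , r₂≡ = begin
      transversalRank (X₁ ∪ X₂) + transversalRank (X₁ ∩ X₂)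
        ≤⟨ +-mono-≤ (transversalRank-≤ (X₁ ∪ X₂) (P ∪ Q)) (transversalRank-≤ (X₁ ∩ X₂) (P ∩ Q)) ⟩
      (cut∪ + #meeting A ((X₁ ∪ X₂) ∩ (P ∪ Q))) + (cut∩ + #meeting A ((X₁ ∩ X₂) ∩ (P ∩ Q)))
        ≡⟨ interchange cut∪ _ cut∩ _ ⟩
      (cut∪ + cut∩) + (#meeting A ((X₁ ∪ X₂) ∩ (P ∪ Q)) + #meeting A ((X₁ ∩ X₂) ∩ (P ∩ Q)))
        ≤⟨ +-mono-≤ (∣─∣-submodular X₁ X₂ P Q)
                    (≤-trans (+-mono-≤ (#meeting-mono A (p∩q⊆q _ _)) (#meeting-mono A (p∩q⊆q _ _))) (#meeting-submod A P Q)) ⟩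
      (∣ X₁ ─ P ∣ + ∣ X₂ ─ Q ∣) + (#meeting A P + #meeting A Q)
        ≤⟨ +-monoˡ-≤ _ (+-mono-≤ (p⊆q⇒∣p∣≤∣q∣ (p∩r⊆q⇒p─q⊆p─r {p = X₁} {P} {Y₁} id))
                                 (p⊆q⇒∣p∣≤∣q∣ (p∩r⊆q⇒p─q⊆p─r {p = X₂} {Q} {Y₂} id))) ⟩
      (∣ X₁ ─ Y₁ ∣ + ∣ X₂ ─ Y₂ ∣) + (#meeting A P + #meeting A Q)
        ≡⟨ interchange ∣ X₁ ─ Y₁ ∣ _ (#meeting A P) _ ⟩
      (∣ X₁ ─ Y₁ ∣ + #meeting A P) + (∣ X₂ ─ Y₂ ∣ + #meeting A Q)
        ≡⟨ cong₂ _+_ r₁≡ r₂≡ ⟨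
      transversalRank X₁ + transversalRank X₂ ∎
      where
      open ≤-Reasoning
      P = X₁ ∩ Y₁
      Q = X₂ ∩ Y₂
      cut∪ = ∣ (X₁ ∪ X₂) ─ (P ∪ Q) ∣
      cut∩ = ∣ (X₁ ∩ X₂) ─ (P ∩ Q) ∣

  transversalMatroid : Matroid m
  transversalMatroid = record { rank = transversalRank ; rank-≤-card = ≤-card ; rank-mono = mono ; rank-submod = submod }

  transversal-Indep⇔Hall : ∀ X → Indep transversalMatroid X ⇔ HallCondition A X
  transversal-Indep⇔Hall X = mk⇔ to from
    where
    to : Indep transversalMatroid X → HallCondition A X
    to indep Y Y⊆X = +-cancelʳ-≤ ∣ X ─ Y ∣ _ _ (begin
      ∣ Y ∣ + ∣ X ─ Y ∣              ≤⟨ +-monoˡ-≤ _ (p⊆q⇒∣p∣≤∣q∣ (λ y∈Y → x∈p∩q⁺ (Y⊆X y∈Y , y∈Y))) ⟩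
      ∣ X ∩ Y ∣ + ∣ X ─ Y ∣          ≡⟨ ∣p∣≡∣p∩q∣+∣p─q∣ X Y ⟨
      ∣ X ∣                          ≡⟨ indep ⟨
      transversalRank X              ≤⟨ transversalRank-≤ X Y ⟩
      ∣ X ─ Y ∣ + #meeting A (X ∩ Y) ≤⟨ +-monoʳ-≤ _ (#meeting-mono A (p∩q⊆q X Y)) ⟩
      ∣ X ─ Y ∣ + #meeting A Y       ≡⟨ +-comm ∣ X ─ Y ∣ (#meeting A Y) ⟩
      #meeting A Y + ∣ X ─ Y ∣       ∎)
      where open ≤-Reasoning
    from : HallCondition A X → Indep transversalMatroid X
    from hall = ≤-antisym (≤-card X) (≤-minSubset _ λ Y → begin
      ∣ X ∣                          ≡⟨ ∣p∣≡∣p∩q∣+∣p─q∣ X Y ⟩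
      ∣ X ∩ Y ∣ + ∣ X ─ Y ∣          ≤⟨ +-monoˡ-≤ _ (hall (X ∩ Y) (p∩q⊆p X Y)) ⟩
      #meeting A (X ∩ Y) + ∣ X ─ Y ∣ ≡⟨ +-comm (#meeting A (X ∩ Y)) ∣ X ─ Y ∣ ⟩
      ∣ X ─ Y ∣ + #meeting A (X ∩ Y) ∎)
      where open ≤-Reasoning

  transversal-Indep⇔IsPartialTransversal : ∀ X → Indep transversalMatroid X ⇔ IsPartialTransversal A X
  transversal-Indep⇔IsPartialTransversal X = mk⇔
    (Hall⇒IsPartialTransversal ∘ Equivalence.to (transversal-Indep⇔Hall X))
    (Equivalence.from (transversal-Indep⇔Hall X) ∘ IsPartialTransversal⇒Hall)

  transversalMatroid-union : IsMatroidUnion transversalMatroid (rankOne ∘ A)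
  transversalMatroid-union X = mk⇔
    (λ indep → let (I , small , X≡⋃I) = Equivalence.to (transversal-Indep⇔IsPartialTransversal X) indep
               in I , (λ i → Equivalence.from (rankOne-Indep⇔ (A i) (I i)) (small i)) , X≡⋃I)
    (λ (I , indep , X≡⋃I) → Equivalence.from (transversal-Indep⇔IsPartialTransversal X)
               (I , (λ i → Equivalence.to (rankOne-Indep⇔ (A i) (I i)) (indep i)) , X≡⋃I))

  transversalMatroid-isTransversal : (∀ i → ∃ λ x → x ∈ A i) → IsTransversal transversalMatroid
  transversalMatroid-isTransversal nonempty = k , rankOne ∘ A , rank-one , transversalMatroid-union
    where
    rank-one : ∀ i → rank (rankOne (A i)) ⊤ ≡ 1
    rank-one i = let (x , x∈Aᵢ) = nonempty i in 𝟙-yes (nonempty? (A i ∩ ⊤)) (x , x∈p∩q⁺ (x∈Aᵢ , ∈⊤))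

  transversalRank-≤-#meeting : ∀ Y → transversalRank Y ≤ #meeting A Y
  transversalRank-≤-#meeting Y = begin
    transversalRank Y              ≤⟨ transversalRank-≤ Y Y ⟩
    ∣ Y ─ Y ∣ + #meeting A (Y ∩ Y) ≡⟨ cong (_+ #meeting A (Y ∩ Y)) (∣p─p∣≡0 Y) ⟩
    #meeting A (Y ∩ Y)             ≤⟨ #meeting-mono A (p∩q⊆p Y Y) ⟩
    #meeting A Y                   ∎
    where open ≤-Reasoning

module _ (T : Matroid m) (Ms : Fin k → Matroid m) (rank-one : ∀ i → rank (Ms i) ⊤ ≡ 1) (union : IsMatroidUnion T Ms) where

  union-Indep⇔IsPartialTransversal : ∀ X → Indep T X ⇔ IsPartialTransversal (nonloops ∘ Ms) X
  union-Indep⇔IsPartialTransversal X = mk⇔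
    (λ indep → let (I , indep-I , X≡⋃I) = Equivalence.to (union X) indep
               in I , (λ i → Equivalence.to (rankOne⇔ i (I i)) (indep-I i)) , X≡⋃I)
    (λ (I , small , X≡⋃I) → Equivalence.from (union X) (I , (λ i → Equivalence.from (rankOne⇔ i (I i)) (small i)) , X≡⋃I))
    where
    rankOne⇔ : ∀ i → ∀ I → Indep (Ms i) I ⇔ (I ⊆ nonloops (Ms i) × ∣ I ∣ ≤ 1)
    rankOne⇔ i = Indep⇔⊆nonloops (Ms i) (≤-reflexive (rank-one i))

  rank≡transversalRank : ∀ W → rank T W ≡ transversalRank (nonloops ∘ Ms) W
  rank≡transversalRank = Indep⇔⇒rank≡ T (transversalMatroid (nonloops ∘ Ms)) λ X → mk⇔
    (Equivalence.from (transversal-Indep⇔IsPartialTransversal _ X) ∘ Equivalence.to (union-Indep⇔IsPartialTransversal X))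
    (Equivalence.from (union-Indep⇔IsPartialTransversal X) ∘ Equivalence.to (transversal-Indep⇔IsPartialTransversal _ X))

-- Expansions

quotient-combine : ∀ t (e : Fin n) (j : Fin t) → quotient {n} t (combine e j) ≡ e
quotient-combine t e j = cong proj₁ (remQuot-combine e j)

∣S∣≡*∣∣ : ∀ t (V : Subset n) → ∣ S[ t ] V ∣ ≡ t * ∣ V ∣
∣S∣≡*∣∣ {n} t V = begin
  ∣ S[ t ] V ∣                                          ≡⟨ ∣∣≡∑ (S[ t ] V) ⟩
  ∑[ x < n * t ] ⟦ lookup (S[ t ] V) x ⟧                      ≡⟨ ∑-combine n t (λ x → ⟦ lookup (S[ t ] V) x ⟧) ⟩
  ∑[ e < n ] ∑[ j < t ] ⟦ lookup (S[ t ] V) (combine e j) ⟧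
    ≡⟨ sum-cong-≗ (λ e → trans (sum-cong-≗ (λ j → cong ⟦_⟧ (S-combine e j))) (∑-const t _)) ⟩
  ∑[ e < n ] (t * ⟦ lookup V e ⟧)                             ≡⟨ *-distribˡ-sum t (λ e → ⟦ lookup V e ⟧) ⟨
  t * ∑[ e < n ] ⟦ lookup V e ⟧                               ≡⟨ cong (t *_) (∣∣≡∑ V) ⟨
  t * ∣ V ∣                                             ∎
  where
  open ≡-Reasoning
  S-combine : ∀ e j → lookup (S[ t ] V) (combine e j) ≡ lookup V e
  S-combine e j = trans (lookup∘tabulate (lookup V ∘ quotient {n} t) (combine e j)) (cong (lookup V) (quotient-combine t e j))

S-─ : ∀ t (U V : Subset n) → S[ t ] U ─ S[ t ] V ≡ S[ t ] (U ─ V)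
S-─ {n} t U V = ⊆-antisym ⊆S[U─V] S[U─V]⊆
  where
  q = quotient {n} t
  ⊆S[U─V] : S[ t ] U ─ S[ t ] V ⊆ S[ t ] (U ─ V)
  ⊆S[U─V] x∈ = ∈-preimage⁺ q {U ─ V} (x∈p∧x∉q⇒x∈p─q (∈-preimage⁻ q {U} (p─q⊆p (S[ t ] U) (S[ t ] V) x∈))
                                                     (λ qx∈V → x∈p─q⇒x∉q x∈ (∈-preimage⁺ q {V} qx∈V)))
  S[U─V]⊆ : S[ t ] (U ─ V) ⊆ S[ t ] U ─ S[ t ] V
  S[U─V]⊆ x∈ = let qx∈U─V = ∈-preimage⁻ q {U ─ V} x∈ in
    x∈p∧x∉q⇒x∈p─q (∈-preimage⁺ q {U} (p─q⊆p U V qx∈U─V)) (λ x∈SV → x∈p─q⇒x∉q qx∈U─V (∈-preimage⁻ q {V} x∈SV))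

∣S─S∣≡*∣─∣ : ∀ t (U V : Subset n) → ∣ S[ t ] U ─ S[ t ] V ∣ ≡ t * ∣ U ─ V ∣
∣S─S∣≡*∣─∣ t U V = trans (cong ∣_∣ (S-─ t U V)) (∣S∣≡*∣∣ t (U ─ V))

expansionRank : ∀ t → Matroid n → Subset (n * t) → ℕ
expansionRank t M X = minSubset λ B → t * rank M B + ∣ X ─ S[ t ] B ∣

expansionRank-≤ : ∀ t (M : Matroid n) X B → expansionRank t M X ≤ t * rank M B + ∣ X ─ S[ t ] B ∣
expansionRank-≤ t M X = minSubset-≤ (λ B → t * rank M B + ∣ X ─ S[ t ] B ∣)

expansionRank-attained : ∀ t (M : Matroid n) X → ∃ λ B → expansionRank t M X ≡ t * rank M B + ∣ X ─ S[ t ] B ∣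
expansionRank-attained t M X = minSubset-attained (λ B → t * rank M B + ∣ X ─ S[ t ] B ∣)

expansionRank-cong : ∀ t (M M′ : Matroid n) → (∀ X → rank M X ≡ rank M′ X) →
                     ∀ X → expansionRank t M X ≡ expansionRank t M′ X
expansionRank-cong t M M′ same X = minSubset-cong (λ B → cong (λ r → t * r + ∣ X ─ S[ t ] B ∣) (same B))

expansionRank-S : ∀ t (M : Matroid n) Z → expansionRank t M (S[ t ] Z) ≡ t * rank M Z
expansionRank-S t M Z = ≤-antisym (begin
    expansionRank t M (S[ t ] Z)            ≤⟨ expansionRank-≤ t M (S[ t ] Z) Z ⟩
    t * rank M Z + ∣ S[ t ] Z ─ S[ t ] Z ∣  ≡⟨ cong (t * rank M Z +_) (∣p─p∣≡0 (S[ t ] Z)) ⟩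
    t * rank M Z + 0                        ≡⟨ +-identityʳ _ ⟩
    t * rank M Z                            ∎)
  (≤-minSubset _ λ B → begin
    t * rank M Z                            ≤⟨ *-monoʳ-≤ t (rank-≤-rank+∣─∣ M Z B) ⟩
    t * (rank M B + ∣ Z ─ B ∣)              ≡⟨ *-distribˡ-+ t _ _ ⟩
    t * rank M B + t * ∣ Z ─ B ∣            ≡⟨ cong (t * rank M B +_) (∣S─S∣≡*∣─∣ t Z B) ⟨
    t * rank M B + ∣ S[ t ] Z ─ S[ t ] B ∣  ∎)
  where open ≤-Reasoning

rank-expansion : ∀ t (M : Matroid n) (N : Matroid (n * t)) → IsExpansion t M N → ∀ X → rank N X ≡ expansionRank t M X
rank-expansion t M N (cyclicFlats , cyclicFlat-rank) X = ≤-antisym (≤-minSubset _ upper) lower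
  where
  S = S[ t ]
  upper : ∀ B → rank N X ≤ t * rank M B + ∣ X ─ S B ∣
  upper B with ∃-cyclicFlat-below M B
  ... | F , F-cyclicFlat , rF+∣B─F∣≤rB = begin
    rank N X
      ≤⟨ rank-≤-rank+∣─∣ N X (S F) ⟩
    rank N (S F) + ∣ X ─ S F ∣
      ≤⟨ +-mono-≤ (≤-reflexive (cyclicFlat-rank F F-cyclicFlat)) (∣p─r∣≤∣p─q∣+∣q─r∣ X (S B) (S F)) ⟩
    t * rank M F + (∣ X ─ S B ∣ + ∣ S B ─ S F ∣)
      ≡⟨ cong (λ c → t * rank M F + (∣ X ─ S B ∣ + c)) (∣S─S∣≡*∣─∣ t B F) ⟩
    t * rank M F + (∣ X ─ S B ∣ + t * ∣ B ─ F ∣)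
      ≡⟨ solve 4 (λ t r x c → t :* r :+ (x :+ t :* c) := t :* (r :+ c) :+ x) refl t (rank M F) ∣ X ─ S B ∣ ∣ B ─ F ∣ ⟩
    t * (rank M F + ∣ B ─ F ∣) + ∣ X ─ S B ∣
      ≤⟨ +-monoˡ-≤ _ (*-monoʳ-≤ t rF+∣B─F∣≤rB) ⟩
    t * rank M B + ∣ X ─ S B ∣ ∎
    where open ≤-Reasoning
  lower : expansionRank t M X ≤ rank N X
  lower with ∃-cyclicFlat-below N X
  ... | Z , Z-cyclicFlat , rZ+∣X─Z∣≤rX with Equivalence.to (cyclicFlats Z) Z-cyclicFlat
  ...   | A , A-cyclicFlat , refl = ≤-trans (expansionRank-≤ t M X A)
    (≤-trans (≤-reflexive (cong (_+ ∣ X ─ S A ∣) (sym (cyclicFlat-rank A A-cyclicFlat)))) rZ+∣X─Z∣≤rX)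

expandFamily : ∀ t → (Fin k → Subset m) → Fin (k * t) → Subset (m * t)
expandFamily {k} t A κ = S[ t ] (A (quotient {k} t κ))

expandFamily-nonempty : ∀ {t} (A : Fin k → Subset m) → 1 ≤ t → (∀ i → ∃ λ x → x ∈ A i) →
                        ∀ κ → ∃ λ y → y ∈ expandFamily t A κ
expandFamily-nonempty {k} {m} {suc t} A _ nonempty κ =
  let (x , x∈A) = nonempty (quotient {k} (suc t) κ)
  in combine x zero , ∈-preimage⁺ (quotient {m} (suc t)) (subst (_∈ A _) (sym (quotient-combine (suc t) x zero)) x∈A)

#meeting-expandFamily : ∀ t (A : Fin k → Subset m) P →
                        #meeting (expandFamily t A) P ≡ t * #meeting A (image (quotient {m} t) P)
#meeting-expandFamily {k} {m} t A P = begin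
  ∑[ κ < k * t ] rank (rankOne (expandFamily t A κ)) P
    ≡⟨ ∑-combine k t _ ⟩
  ∑[ i < k ] ∑[ j < t ] rank (rankOne (expandFamily t A (combine i j))) P
    ≡⟨ sum-cong-≗ (λ i → trans (sum-cong-≗ (same-meeting i)) (∑-const t _)) ⟩
  ∑[ i < k ] (t * rank (rankOne (A i)) (q[ P ]))
    ≡⟨ *-distribˡ-sum t (λ i → rank (rankOne (A i)) q[ P ]) ⟨
  t * #meeting A q[ P ] ∎
  where
  open ≡-Reasoning
  q = quotient {m} t
  q[_] = image q
  same-meeting : ∀ i j → rank (rankOne (expandFamily t A (combine i j))) P ≡ rank (rankOne (A i)) q[ P ]
  same-meeting i j rewrite quotient-combine t i j =
    𝟙-cong (nonempty? (S[ t ] (A i) ∩ P)) (nonempty? (A i ∩ q[ P ])) to from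
    where
    to : Nonempty (S[ t ] (A i) ∩ P) → Nonempty (A i ∩ q[ P ])
    to (x , x∈) = let (x∈SA , x∈P) = x∈p∩q⁻ (S[ t ] (A i)) P x∈
                  in q x , x∈p∩q⁺ (∈-preimage⁻ q {A i} x∈SA , ∈-image⁺ q x∈P)
    from : Nonempty (A i ∩ q[ P ]) → Nonempty (S[ t ] (A i) ∩ P)
    from (y , y∈) with x∈p∩q⁻ (A i) q[ P ] y∈
    ... | y∈A , y∈qP with ∈-image⁻ q P y∈qP
    ...   | x , x∈P , refl = x , x∈p∩q⁺ (∈-preimage⁺ q {A i} y∈A , x∈P)

module _ (t : ℕ) (A : Fin k → Subset m) where

  transversalRank-expandFamily-≤ : ∀ W B → transversalRank (expandFamily t A) W ≤ t * transversalRank A B + ∣ W ─ S[ t ] B ∣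
  transversalRank-expandFamily-≤ W B with transversalRank-attained A B
  ... | Y , rB≡ = begin
    transversalRank A′ W
      ≤⟨ transversalRank-≤ A′ W (S (B ∩ Y)) ⟩
    ∣ W ─ S (B ∩ Y) ∣ + #meeting A′ (W ∩ S (B ∩ Y))
      ≤⟨ +-mono-≤ cut (≤-reflexive (#meeting-expandFamily t A _)) ⟩
    (∣ W ─ S B ∣ + t * ∣ B ─ Y ∣) + t * #meeting A (image q (W ∩ S (B ∩ Y)))
                                                                  ≤⟨ +-monoʳ-≤ _ (*-monoʳ-≤ t (#meeting-mono A image⊆)) ⟩
    (∣ W ─ S B ∣ + t * ∣ B ─ Y ∣) + t * #meeting A (B ∩ Y)
      ≡⟨ solve 4 (λ t w c d → w :+ t :* c :+ t :* d := t :* (c :+ d) :+ w) refl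
                 t ∣ W ─ S B ∣ ∣ B ─ Y ∣ (#meeting A (B ∩ Y)) ⟩
    t * (∣ B ─ Y ∣ + #meeting A (B ∩ Y)) + ∣ W ─ S B ∣
      ≡⟨ cong (λ r → t * r + ∣ W ─ S B ∣) rB≡ ⟨
    t * transversalRank A B + ∣ W ─ S B ∣ ∎
    where
    open ≤-Reasoning
    A′ = expandFamily t A
    S = S[ t ]
    q = quotient {m} t
    image⊆ : image q (W ∩ S (B ∩ Y)) ⊆ B ∩ Y
    image⊆ y∈ with ∈-image⁻ q (W ∩ S (B ∩ Y)) y∈
    ... | x , x∈ , refl = ∈-preimage⁻ q {B ∩ Y} (p∩q⊆q W (S (B ∩ Y)) x∈)
    cut : ∣ W ─ S (B ∩ Y) ∣ ≤ ∣ W ─ S B ∣ + t * ∣ B ─ Y ∣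
    cut = ≤-trans (∣p─r∣≤∣p─q∣+∣q─r∣ W (S B) (S (B ∩ Y)))
      (+-monoʳ-≤ _ (≤-trans (≤-reflexive (∣S─S∣≡*∣─∣ t B (B ∩ Y)))
                            (*-monoʳ-≤ t (p⊆q⇒∣p∣≤∣q∣ (p∩r⊆q⇒p─q⊆p─r {p = B} {B ∩ Y} {Y} id)))))

  expansionRank-≤-transversalRank-expandFamily : ∀ W →
    expansionRank t (transversalMatroid A) W ≤ transversalRank (expandFamily t A) W
  expansionRank-≤-transversalRank-expandFamily W with transversalRank-attained (expandFamily t A) W
  ... | Y′ , rW≡ = begin
    expansionRank t (transversalMatroid A) W
      ≤⟨ expansionRank-≤ t (transversalMatroid A) W Y ⟩
    t * transversalRank A Y + ∣ W ─ S Y ∣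
      ≤⟨ +-mono-≤ (*-monoʳ-≤ t (transversalRank-≤-#meeting A Y)) (p⊆q⇒∣p∣≤∣q∣ W─SY⊆W─Y′) ⟩
    t * #meeting A Y + ∣ W ─ Y′ ∣
      ≡⟨ cong (_+ ∣ W ─ Y′ ∣) (#meeting-expandFamily t A (W ∩ Y′)) ⟨
    #meeting A′ (W ∩ Y′) + ∣ W ─ Y′ ∣
      ≡⟨ +-comm (#meeting A′ (W ∩ Y′)) _ ⟩
    ∣ W ─ Y′ ∣ + #meeting A′ (W ∩ Y′)
      ≡⟨ rW≡ ⟨
    transversalRank A′ W ∎
    where
    open ≤-Reasoning
    A′ = expandFamily t A
    S = S[ t ]
    q = quotient {m} t
    Y = image q (W ∩ Y′)
    W─SY⊆W─Y′ : W ─ S Y ⊆ W ─ Y′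
    W─SY⊆W─Y′ = p∩r⊆q⇒p─q⊆p─r (∈-preimage⁺ q {Y} ∘ ∈-image⁺ q)

  rank-expandFamily : ∀ W → transversalRank (expandFamily t A) W ≡ expansionRank t (transversalMatroid A) W
  rank-expandFamily W =
    ≤-antisym (≤-minSubset _ (transversalRank-expandFamily-≤ W)) (expansionRank-≤-transversalRank-expandFamily W)

remainder-combine : ∀ t (e : Fin n) (j : Fin t) → remainder {n} t (combine e j) ≡ j
remainder-combine t e j = cong proj₂ (remQuot-combine e j)

module ExpandedMinor (t : ℕ) {M : Matroid n} {T : Matroid m} {C D : Subset m} {ψ : Fin n → Fin m}
  (ψ-injective : Injective _≡_ _≡_ ψ) (ψ-avoids : ∀ i → ψ i ∉ C × ψ i ∉ D)
  (ψ-covers : ∀ j → j ∈ C ⊎ j ∈ D ⊎ ∃ λ i → ψ i ≡ j)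
  (contraction : ∀ X → X ⊆ ∁ (C ∪ D) → rank M (preimage ψ X) + rank T C ≡ rank T (X ∪ C)) where

  expand : Fin (n * t) → Fin (m * t)
  expand x = combine (ψ (quotient {n} t x)) (remainder {n} t x)

  quotient-expand : ∀ x → quotient {m} t (expand x) ≡ ψ (quotient {n} t x)
  quotient-expand x = quotient-combine t _ _

  expand-injective : Injective _≡_ _≡_ expand
  expand-injective {x} {y} expand-x≡expand-y =
    trans (sym (combine-remQuot {n} t x))
          (trans (cong₂ combine (ψ-injective (cong proj₁ same)) (cong proj₂ same)) (combine-remQuot {n} t y))
    where
    same : (ψ (quotient {n} t x) , remainder {n} t x) ≡ (ψ (quotient {n} t y) , remainder {n} t y)
    same = trans (sym (remQuot-combine _ _)) (trans (cong (remQuot {m} t) expand-x≡expand-y) (remQuot-combine _ _))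

  expand-avoids : ∀ x → expand x ∉ S[ t ] C × expand x ∉ S[ t ] D
  expand-avoids x =
      (λ ∈SC → proj₁ (ψ-avoids (quotient {n} t x)) (subst (_∈ C) (quotient-expand x) (∈-preimage⁻ (quotient {m} t) {C} ∈SC)))
    , (λ ∈SD → proj₂ (ψ-avoids (quotient {n} t x)) (subst (_∈ D) (quotient-expand x) (∈-preimage⁻ (quotient {m} t) {D} ∈SD)))

  expand-covers : ∀ y → y ∈ S[ t ] C ⊎ y ∈ S[ t ] D ⊎ ∃ λ x → expand x ≡ y
  expand-covers y with ψ-covers (quotient {m} t y)
  ... | inj₁ qy∈C = inj₁ (∈-preimage⁺ (quotient {m} t) {C} qy∈C)
  ... | inj₂ (inj₁ qy∈D) = inj₂ (inj₁ (∈-preimage⁺ (quotient {m} t) {D} qy∈D))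
  ... | inj₂ (inj₂ (i , ψi≡qy)) = inj₂ (inj₂ (combine i (remainder {m} t y) , (begin
    combine (ψ (quotient {n} t (combine i r))) (remainder {n} t (combine i r))
      ≡⟨ cong₂ combine (cong ψ (quotient-combine t i r)) (remainder-combine t i r) ⟩
    combine (ψ i) r
      ≡⟨ cong (λ j → combine j r) ψi≡qy ⟩
    combine (quotient {m} t y) r
      ≡⟨ combine-remQuot {m} t y ⟩
    y                                                                       ∎)))
    where
    open ≡-Reasoning
    r = remainder {m} t y

  S-disjoint : (∀ j → j ∈ C → j ∉ D) → ∀ y → y ∈ S[ t ] C → y ∉ S[ t ] D
  S-disjoint disjoint y y∈SC y∈SD =
    disjoint (quotient {m} t y) (∈-preimage⁻ (quotient {m} t) {C} y∈SC) (∈-preimage⁻ (quotient {m} t) {D} y∈SD)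

  module _ {X′ : Subset (m * t)} (X′-avoids : X′ ⊆ ∁ (S[ t ] C ∪ S[ t ] D)) where

    X : Subset (n * t)
    X = preimage expand X′

    X′∩SC-empty : Empty (X′ ∩ S[ t ] C)
    X′∩SC-empty (y , y∈) = let (y∈X′ , y∈SC) = x∈p∩q⁻ X′ (S[ t ] C) y∈ in
      x∈∁p⇒x∉p (X′-avoids y∈X′) (x∈p∪q⁺ (inj₁ y∈SC))

    ∣X─S[ψ⁻¹Y]∣≡∣X′─S[Y]∣ : ∀ Y → ∣ X ─ S[ t ] (preimage ψ Y) ∣ ≡ ∣ X′ ─ S[ t ] Y ∣
    ∣X─S[ψ⁻¹Y]∣≡∣X′─S[Y]∣ Y = trans (cong ∣_∣ (⊆-antisym ⊆preimage preimage⊆)) (∣preimage∣≡∣∣ expand-injective in-range)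
      where
      q = quotient {m} t
      SY⇒ : ∀ {x} → x ∈ S[ t ] (preimage ψ Y) → expand x ∈ S[ t ] Y
      SY⇒ {x} x∈ = ∈-preimage⁺ q {Y}
        (subst (_∈ Y) (sym (quotient-expand x)) (∈-preimage⁻ ψ {Y} (∈-preimage⁻ (quotient {n} t) {preimage ψ Y} x∈)))
      ⇒SY : ∀ {x} → expand x ∈ S[ t ] Y → x ∈ S[ t ] (preimage ψ Y)
      ⇒SY {x} ∈SY = ∈-preimage⁺ (quotient {n} t) {preimage ψ Y}
        (∈-preimage⁺ ψ {Y} (subst (_∈ Y) (quotient-expand x) (∈-preimage⁻ q {Y} ∈SY)))
      ⊆preimage : X ─ S[ t ] (preimage ψ Y) ⊆ preimage expand (X′ ─ S[ t ] Y)
      ⊆preimage x∈ = ∈-preimage⁺ expand {X′ ─ S[ t ] Y}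
        (x∈p∧x∉q⇒x∈p─q (∈-preimage⁻ expand {X′} (p─q⊆p X _ x∈)) (x∈p─q⇒x∉q x∈ ∘ ⇒SY))
      preimage⊆ : preimage expand (X′ ─ S[ t ] Y) ⊆ X ─ S[ t ] (preimage ψ Y)
      preimage⊆ x∈ = let ex∈ = ∈-preimage⁻ expand {X′ ─ S[ t ] Y} x∈ in
        x∈p∧x∉q⇒x∈p─q (∈-preimage⁺ expand {X′} (p─q⊆p X′ _ ex∈)) (x∈p─q⇒x∉q ex∈ ∘ SY⇒)
      in-range : ∀ {y} → y ∈ X′ ─ S[ t ] Y → ∃ λ x → expand x ≡ y
      in-range {y} y∈ with p─q⊆p X′ _ y∈ | expand-covers y
      ... | y∈X′ | inj₁ y∈SC        = contradiction (x∈p∪q⁺ (inj₁ y∈SC)) (x∈∁p⇒x∉p (X′-avoids y∈X′))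
      ... | y∈X′ | inj₂ (inj₁ y∈SD) = contradiction (x∈p∪q⁺ (inj₂ y∈SD)) (x∈∁p⇒x∉p (X′-avoids y∈X′))
      ... | _    | inj₂ (inj₂ hit)  = hit

    image⊆∁ : ∀ B → image ψ B ⊆ ∁ (C ∪ D)
    image⊆∁ B y∈ with ∈-image⁻ ψ B y∈
    ... | i , _ , refl = x∉p⇒x∈∁p λ ψi∈C∪D → [ proj₁ (ψ-avoids i) , proj₂ (ψ-avoids i) ]′ (x∈p∪q⁻ C D ψi∈C∪D)

    rank-image∪C : ∀ B → rank T (image ψ B ∪ C) ≡ rank M B + rank T C
    rank-image∪C B =
      trans (sym (contraction (image ψ B) (image⊆∁ B))) (cong (λ Z → rank M Z + rank T C) (preimage-image ψ-injective B))

    expansionRank-contraction-≤ : ∀ B′ →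
      expansionRank t M X + t * rank T C ≤ t * rank T B′ + ∣ (X′ ∪ S[ t ] C) ─ S[ t ] B′ ∣
    expansionRank-contraction-≤ B′ = begin
      expansionRank t M X + t * rank T C
        ≤⟨ +-monoˡ-≤ _ (expansionRank-≤ t M X B) ⟩
      t * rank M B + ∣ X ─ S B ∣ + t * rank T C
        ≡⟨ solve 4 (λ t r b c → t :* r :+ b :+ t :* c := t :* (r :+ c) :+ b) refl t (rank M B) ∣ X ─ S B ∣ (rank T C) ⟩
      t * (rank M B + rank T C) + ∣ X ─ S B ∣
        ≡⟨ cong₂ (λ r c → t * r + c) (rank-image∪C B) (sym (∣X─S[ψ⁻¹Y]∣≡∣X′─S[Y]∣ B′)) ⟨
      t * rank T (image ψ B ∪ C) + ∣ X′ ─ S B′ ∣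
        ≤⟨ +-monoˡ-≤ _ (*-monoʳ-≤ t (rank-mono T image∪C⊆)) ⟩
      t * rank T (B′ ∪ C) + ∣ X′ ─ S B′ ∣
        ≤⟨ +-monoˡ-≤ _ (*-monoʳ-≤ t (rank-∪-≤ T B′ C)) ⟩
      t * (rank T B′ + ∣ C ─ B′ ∣) + ∣ X′ ─ S B′ ∣
        ≡⟨ solve 4 (λ t r c x → t :* (r :+ c) :+ x := t :* r :+ (x :+ t :* c)) refl
                   t (rank T B′) ∣ C ─ B′ ∣ ∣ X′ ─ S B′ ∣ ⟩
      t * rank T B′ + (∣ X′ ─ S B′ ∣ + t * ∣ C ─ B′ ∣)
        ≡⟨ cong (λ c → t * rank T B′ + (∣ X′ ─ S B′ ∣ + c)) (∣S─S∣≡*∣─∣ t C B′) ⟨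
      t * rank T B′ + (∣ X′ ─ S B′ ∣ + ∣ S C ─ S B′ ∣)
        ≤⟨ +-monoʳ-≤ _ (∣p─r∣+∣q─r∣≤∣p∪q─r∣ X′ (S C) (S B′) X′∩SC-empty) ⟩
      t * rank T B′ + ∣ (X′ ∪ S C) ─ S B′ ∣ ∎
      where
      open ≤-Reasoning
      S : ∀ {a} → Subset a → Subset (a * t)
      S = S[ t ]
      B = preimage ψ B′
      image∪C⊆ : image ψ B ∪ C ⊆ B′ ∪ C
      image∪C⊆ y∈ = [ x∈p∪q⁺ ∘ inj₁ ∘ image-preimage⊆ ψ B′ , x∈p∪q⁺ ∘ inj₂ ]′ (x∈p∪q⁻ (image ψ B) C y∈)

    expansionRank-contraction-≥ : expansionRank t T (X′ ∪ S[ t ] C) ≤ expansionRank t M X + t * rank T C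
    expansionRank-contraction-≥ with expansionRank-attained t M X
    ... | B , rX≡ = begin
      expansionRank t T (X′ ∪ S C)
        ≤⟨ expansionRank-≤ t T (X′ ∪ S C) (image ψ B ∪ C) ⟩
      t * rank T (image ψ B ∪ C) + ∣ (X′ ∪ S C) ─ S (image ψ B ∪ C) ∣
        ≤⟨ +-monoʳ-≤ _ (p⊆q⇒∣p∣≤∣q∣ cut) ⟩
      t * rank T (image ψ B ∪ C) + ∣ X′ ─ S (image ψ B) ∣
        ≡⟨ cong₂ (λ r c → t * r + c) (rank-image∪C B) ∣X′─S[ψB]∣≡ ⟩
      t * (rank M B + rank T C) + ∣ X ─ S B ∣
        ≡⟨ solve 4 (λ t r c b → t :* (r :+ c) :+ b := t :* r :+ b :+ t :* c) refl t (rank M B) (rank T C) ∣ X ─ S B ∣ ⟩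
      t * rank M B + ∣ X ─ S B ∣ + t * rank T C
        ≡⟨ cong (_+ t * rank T C) rX≡ ⟨
      expansionRank t M X + t * rank T C ∎
      where
      open ≤-Reasoning
      S : ∀ {a} → Subset a → Subset (a * t)
      S = S[ t ]
      ∣X′─S[ψB]∣≡ : ∣ X′ ─ S (image ψ B) ∣ ≡ ∣ X ─ S B ∣
      ∣X′─S[ψB]∣≡ =
        trans (sym (∣X─S[ψ⁻¹Y]∣≡∣X′─S[Y]∣ (image ψ B))) (cong (λ Z → ∣ X ─ S Z ∣) (preimage-image ψ-injective B))
      SC⊆ : S C ⊆ S (image ψ B ∪ C)
      SC⊆ y∈SC =
        ∈-preimage⁺ (quotient {m} t) {image ψ B ∪ C} (x∈p∪q⁺ (inj₂ (∈-preimage⁻ (quotient {m} t) {C} y∈SC)))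
      SψB⊆ : S (image ψ B) ⊆ S (image ψ B ∪ C)
      SψB⊆ y∈SψB =
        ∈-preimage⁺ (quotient {m} t) {image ψ B ∪ C} (x∈p∪q⁺ (inj₁ (∈-preimage⁻ (quotient {m} t) {image ψ B} y∈SψB)))
      cut : (X′ ∪ S C) ─ S (image ψ B ∪ C) ⊆ X′ ─ S (image ψ B)
      cut y∈ with x∈p∪q⁻ X′ (S C) (p─q⊆p _ _ y∈)
      ... | inj₂ y∈SC = contradiction (SC⊆ y∈SC) (x∈p─q⇒x∉q y∈)
      ... | inj₁ y∈X′ = x∈p∧x∉q⇒x∈p─q y∈X′ (x∈p─q⇒x∉q y∈ ∘ SψB⊆)

    expansionRank-contraction : expansionRank t M X + t * rank T C ≡ expansionRank t T (X′ ∪ S[ t ] C)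
    expansionRank-contraction = ≤-antisym (≤-minSubset _ expansionRank-contraction-≤) expansionRank-contraction-≥

corollary3p14 : ∀ {n : ℕ} (t : ℕ) → 1 ≤ t → (M : Matroid n) (N : Matroid (n * t)) →
    IsExpansion t M N → IsGammoid M → IsGammoid N
corollary3p14 t 1≤t M N expansion
  (m , T , (k , Ms , rank-one , union) , C , D , ψ , disjoint , ψ-injective , ψ-avoids , ψ-covers , contraction) =
  m * t , T′ , transversalMatroid-isTransversal A′ A′-nonempty ,
  S[ t ] C , S[ t ] D , expand , S-disjoint disjoint , expand-injective , expand-avoids , expand-covers , rank-identity
  where
  open ExpandedMinor t {M} {T} ψ-injective ψ-avoids ψ-covers contraction
  A : Fin k → Subset m
  A = nonloops ∘ Ms
  A′ : Fin (k * t) → Subset (m * t)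
  A′ = expandFamily t A
  T′ : Matroid (m * t)
  T′ = transversalMatroid A′
  A′-nonempty : ∀ κ → ∃ λ y → y ∈ A′ κ
  A′-nonempty = expandFamily-nonempty A 1≤t (λ i → rank⊤≡1⇒∃nonloop (Ms i) (rank-one i))
  rank-T′ : ∀ W → rank T′ W ≡ expansionRank t T W
  rank-T′ W = trans (rank-expandFamily t A W)
                    (expansionRank-cong t (transversalMatroid A) T (sym ∘ rank≡transversalRank T Ms rank-one union) W)
  rank-identity : ∀ X′ → X′ ⊆ ∁ (S[ t ] C ∪ S[ t ] D) →
                  rank N (preimage expand X′) + rank T′ (S[ t ] C) ≡ rank T′ (X′ ∪ S[ t ] C)
  rank-identity X′ X′-avoids = begin
    rank N (preimage expand X′) + rank T′ (S[ t ] C)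
      ≡⟨ cong₂ _+_ (rank-expansion t M N expansion (preimage expand X′)) (trans (rank-T′ (S[ t ] C)) (expansionRank-S t T C)) ⟩
    expansionRank t M (preimage expand X′) + t * rank T C
      ≡⟨ expansionRank-contraction X′-avoids ⟩
    expansionRank t T (X′ ∪ S[ t ] C)
      ≡⟨ rank-T′ (X′ ∪ S[ t ] C) ⟨
    rank T′ (X′ ∪ S[ t ] C) ∎
    where open ≡-Reasoning
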